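{- Let $P$ be an odd prime and $r$ a positive integer. On the set of positive integers $m$ with $\upsilon_2(m)\notin\{1,2\}$ and $(m,P)=1$, the function $\theta_r(m)$ is multiplicative, and it is given on prime powers as follows. If $r$ is odd: for a prime $p$ with $(p,2r)=1$, $\theta_r(p^\alpha)=-p^{\alpha-1}$ for $\alpha$ odd and $\theta_r(p^\alpha)=p^{\alpha-1}(p-2)$ for $\alpha$ even; for a prime $p\mid r$, $\theta_r(p^\alpha)=0$ for $\alpha$ odd and $\theta_r(p^\alpha)=p^{\alpha-1}(p-1)$ for $\alpha$ even; and $\theta_r(2^\alpha)=(-1)^\alpha2^{\alpha-1}$. If $r$ is even: $\theta_r(2^\alpha)=0$ for every $\alpha$ for which it is defined, and for an odd prime $p$, $\theta_r(p^\alpha)=\theta_{r'}(p^\alpha)$, where $r'$ is the odd part of $r$.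
   Context: $\upsilon_2$ is the $2$-adic valuation. For a positive integer $m$ with $\upsilon_2(m)\notin\{1,2\}$ (so $\theta_r(2^\alpha)$ is defined for $\alpha=0$ and $\alpha\ge3$) and a prime $P$, $\theta_r(m):=\sum_{a\bmod m}\left(\frac{a}{m}\right)\left(\frac{ar^2-4P}{m}\right)$, where $\left(\frac{\cdot}{m}\right)$ is the Kronecker symbol (which is periodic modulo $m$ for such $m$). -}

module Defs where

open import Data.Bool using (Bool; true; false; if_then_else_)
open import Data.Nat as ℕ using (ℕ; zero; suc; _≡ᵇ_)
open import Data.Nat.DivMod using (_%_; _/_)
open import Data.List using (List; upTo)
open import Data.Bool.ListAction using (any)
open import Data.Integer as ℤ using (ℤ; +_; _%ℕ_)

legendre : ℤ → (k : ℕ) → ℤ   -- p = k + 2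
legendre a k with a %ℕ suc (suc k)
... | zero = + 0
... | r@(suc _) =
  if any (λ x → ((x ℕ.* x) % suc (suc k)) ≡ᵇ r) (upTo (suc (suc k)))
  then + 1 else ℤ.- (+ 1)

kron2 : ℤ → ℤ
kron2 a with a %ℕ 8
... | 1 = + 1
... | 7 = + 1
... | 3 = ℤ.- (+ 1)
... | 5 = ℤ.- (+ 1)
... | _ = + 0

-- (a/p) for a prime p = k + 2
primeSym : ℤ → ℕ → ℤ
primeSym a zero = kron2 a
primeSym a k@(suc _) = legendre a k

-- smallest divisor d ≥ k+2 of m (searching with fuel); returns d ∸ 2
minFactorFrom : ℕ → ℕ → ℕ → ℕ
minFactorFrom zero k m = m ℕ.∸ 2
minFactorFrom (suc f) k m =
  if (m % suc (suc k)) ≡ᵇ 0 then k else minFactorFrom f (suc k) m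

-- smallest prime factor of m ≥ 2, minus 2
spf : ℕ → ℕ
spf m = minFactorFrom m 0 m

kronAux : ℕ → ℤ → ℕ → ℤ
kronAux zero a m = + 1
kronAux (suc f) a zero = + 0
kronAux (suc f) a (suc zero) = + 1
kronAux (suc f) a m@(suc (suc _)) =
  primeSym a (spf m) ℤ.* kronAux f a (m / suc (suc (spf m)))

-- Kronecker symbol (a/m) for a positive integer m: the completely
-- multiplicative extension (in m) of the prime symbols (a/p) over the
-- prime factorisation of m (fuel m suffices since each step halves m).
kronecker : ℤ → ℕ → ℤ
kronecker a m = kronAux m a m

sumℤ : ℕ → (ℕ → ℤ) → ℤ
sumℤ zero f = + 0
sumℤ (suc n) f = sumℤ n f ℤ.+ f n

θ : (r P m : ℕ) → ℤ
θ r P m = sumℤ m (λ a →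
  kronecker (+ a) m ℤ.* kronecker (+ (a ℕ.* (r ℕ.* r)) ℤ.- + (4 ℕ.* P)) m)

v2Aux : ℕ → ℕ → ℕ
v2Aux zero m = 0
v2Aux (suc f) zero = 0
v2Aux (suc f) m@(suc _) =
  if (m % 2) ≡ᵇ 0 then suc (v2Aux f (m / 2)) else 0

υ₂ : ℕ → ℕ
υ₂ m = v2Aux m m

oddAux : ℕ → ℕ → ℕ
oddAux zero m = m
oddAux (suc f) zero = zero
oddAux (suc f) m@(suc _) =
  if (m % 2) ≡ᵇ 0 then oddAux f (m / 2) else m

oddPart : ℕ → ℕ
oddPart m = oddAux m m

module Submission where

-- Writing θ_r(m) = Σ_a (a/m)((ar² − 4P)/m): when υ₂(m) ∉ {1,2} both Kronecker symbols are
-- periodic in a modulo m, and they are completely multiplicative in m, so for coprime m and n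
-- the Chinese remainder theorem factors the sum over a mod mn.
-- At an odd prime p ∤ P the summand at p^α is W(a)^α with W(a) = (a/p)((ar² − 4P)/p) of
-- period p and W³ = W, so θ_r(p^α) = p^(α−1) Σ_{a mod p} W(a) for α odd and p^(α−1) Σ W(a)²
-- for α even. The first sum is −(r²/p), an instance of the quadratic character sum
-- Σ_a (a/p)((ac + D)/p) = −(c/p) for p ∤ D; the second counts the a with a ≢ 0 and ar² ≢ 4P,
-- which is p − 2 or p − 1 according as p ∤ r or p ∣ r.
-- At 2^α the symbol only sees residues mod 8: for r even ar² − 4P is even, and for r, P odd
-- ar² − 4P ≡ a + 4 (mod 8), so each period of 8 contributes 4(−1)^α.

open import Defs
open import Data.Nat using (ℕ; NonZero; suc)
open import Data.Nat.Divisibility using (_∣_)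
open import Data.Nat.Primality using (Prime)
open import Relation.Nullary using (¬_)

module FiniteSum where

  open import Data.Nat as ℕ using (zero)
  import Data.Nat.Properties as ℕP
  open import Data.Integer using (ℤ; +_; _+_; _-_; _*_; -_; 0ℤ; 1ℤ; _≤_; +≤+)
  open import Data.Integer.Base using (nonNegative)
  open import Data.Integer.Properties
    using (_≟_; +-commutativeSemigroup; +-assoc; +-comm; +-identityʳ; +-inverseʳ; +-mono-≤; neg-distrib-+; *-identityˡ; *-zeroˡ; *-zeroʳ;
           *-distribˡ-+; *-distribʳ-+; ≤-antisym; i≤i+j; i≤j+i; i≤j⇒0≤j-i; i-j≡0⇒i≡j)
  open import Algebra.Properties.CommutativeSemigroup +-commutativeSemigroup using (interchange; xy∙z≈xz∙y)
  open import Data.Product using (∃; _×_; _,_; proj₁; proj₂)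
  open import Data.Empty using (⊥-elim)
  open import Function using (_∘_)
  open import Relation.Binary.PropositionalEquality
  open import Relation.Nullary using (Dec; yes; no)

  sumℤ-cong : ∀ n {f g : ℕ → ℤ} → (∀ i → i ℕ.< n → f i ≡ g i) → sumℤ n f ≡ sumℤ n g
  sumℤ-cong zero    f≗g = refl
  sumℤ-cong (suc n) f≗g = cong₂ _+_ (sumℤ-cong n (λ i i<n → f≗g i (ℕP.m<n⇒m<1+n i<n))) (f≗g n ℕP.≤-refl)

  sumℤ-0 : ∀ n → sumℤ n (λ _ → 0ℤ) ≡ 0ℤ
  sumℤ-0 zero    = refl
  sumℤ-0 (suc n) = cong (_+ 0ℤ) (sumℤ-0 n)

  sumℤ-const : ∀ n c → sumℤ n (λ _ → c) ≡ + n * c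
  sumℤ-const zero    c = sym (*-zeroˡ c)
  sumℤ-const (suc n) c = begin
    sumℤ n (λ _ → c) + c  ≡⟨ cong (_+ c) (sumℤ-const n c) ⟩
    + n * c + c           ≡⟨ cong (_+_ (+ n * c)) (sym (*-identityˡ c)) ⟩
    + n * c + 1ℤ * c      ≡⟨ *-distribʳ-+ c (+ n) 1ℤ ⟨
    (+ n + 1ℤ) * c        ≡⟨ cong (λ k → + k * c) (ℕP.+-comm n 1) ⟩
    + suc n * c           ∎
    where open ≡-Reasoning

  sumℤ-+ : ∀ n (f g : ℕ → ℤ) → sumℤ n (λ i → f i + g i) ≡ sumℤ n f + sumℤ n g
  sumℤ-+ zero    f g = refl
  sumℤ-+ (suc n) f g = trans (cong (_+ (f n + g n)) (sumℤ-+ n f g)) (interchange (sumℤ n f) (sumℤ n g) (f n) (g n))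

  sumℤ-neg : ∀ n (f : ℕ → ℤ) → sumℤ n (λ i → - f i) ≡ - sumℤ n f
  sumℤ-neg zero    f = refl
  sumℤ-neg (suc n) f = trans (cong (_+ - f n) (sumℤ-neg n f)) (sym (neg-distrib-+ (sumℤ n f) (f n)))

  sumℤ-sub : ∀ n (f g : ℕ → ℤ) → sumℤ n (λ i → f i - g i) ≡ sumℤ n f - sumℤ n g
  sumℤ-sub n f g = trans (sumℤ-+ n f (λ i → - g i)) (cong (_+_ (sumℤ n f)) (sumℤ-neg n g))

  sumℤ-*ˡ : ∀ n c (f : ℕ → ℤ) → sumℤ n (λ i → c * f i) ≡ c * sumℤ n f
  sumℤ-*ˡ zero    c f = sym (*-zeroʳ c)
  sumℤ-*ˡ (suc n) c f = trans (cong (_+ c * f n) (sumℤ-*ˡ n c f)) (sym (*-distribˡ-+ c (sumℤ n f) (f n)))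

  sumℤ-suc : ∀ n (f : ℕ → ℤ) → sumℤ (suc n) f ≡ f 0 + sumℤ n (f ∘ suc)
  sumℤ-suc zero    f = +-comm 0ℤ (f 0)
  sumℤ-suc (suc n) f = trans (cong (_+ f (suc n)) (sumℤ-suc n f)) (+-assoc (f 0) (sumℤ n (f ∘ suc)) (f (suc n)))

  sumℤ-++ : ∀ m k (f : ℕ → ℤ) → sumℤ (m ℕ.+ k) f ≡ sumℤ m f + sumℤ k (λ i → f (m ℕ.+ i))
  sumℤ-++ m zero    f rewrite ℕP.+-identityʳ m = sym (+-identityʳ _)
  sumℤ-++ m (suc k) f rewrite ℕP.+-suc m k =
    trans (cong (_+ f (m ℕ.+ k)) (sumℤ-++ m k f)) (+-assoc (sumℤ m f) _ _)

  sumℤ-* : ∀ n m (f : ℕ → ℤ) → sumℤ (n ℕ.* m) f ≡ sumℤ n (λ j → sumℤ m (λ x → f (j ℕ.* m ℕ.+ x)))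
  sumℤ-* zero    m f = refl
  sumℤ-* (suc n) m f = begin
    sumℤ (m ℕ.+ n ℕ.* m) f
      ≡⟨ sumℤ-++ m (n ℕ.* m) f ⟩
    sumℤ m f + sumℤ (n ℕ.* m) (λ i → f (m ℕ.+ i))
      ≡⟨ cong (_+_ (sumℤ m f)) (sumℤ-* n m (λ i → f (m ℕ.+ i))) ⟩
    sumℤ m f + sumℤ n (λ j → sumℤ m (λ x → f (m ℕ.+ (j ℕ.* m ℕ.+ x))))
      ≡⟨ cong (_+_ (sumℤ m f)) (sumℤ-cong n (λ j _ → sumℤ-cong m (λ x _ →
           cong f (sym (ℕP.+-assoc m (j ℕ.* m) x))))) ⟩
    sumℤ m f + sumℤ n (λ j → sumℤ m (λ x → f (suc j ℕ.* m ℕ.+ x)))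
      ≡⟨ sumℤ-suc n (λ j → sumℤ m (λ x → f (j ℕ.* m ℕ.+ x))) ⟨
    sumℤ (suc n) (λ j → sumℤ m (λ x → f (j ℕ.* m ℕ.+ x))) ∎
    where open ≡-Reasoning

  sumℤ-comm : ∀ n m (f : ℕ → ℕ → ℤ) →
    sumℤ n (λ i → sumℤ m (λ j → f i j)) ≡ sumℤ m (λ j → sumℤ n (λ i → f i j))
  sumℤ-comm zero    m f = sym (sumℤ-0 m)
  sumℤ-comm (suc n) m f = trans (cong (_+ sumℤ m (f n)) (sumℤ-comm n m f))
    (sym (sumℤ-+ m (λ j → sumℤ n (λ i → f i j)) (f n)))

  sumℤ-periodic : ∀ t m (f : ℕ → ℤ) → (∀ i → f (m ℕ.+ i) ≡ f i) → sumℤ (t ℕ.* m) f ≡ + t * sumℤ m f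
  sumℤ-periodic t m f per = begin
    sumℤ (t ℕ.* m) f                               ≡⟨ sumℤ-* t m f ⟩
    sumℤ t (λ j → sumℤ m (λ x → f (j ℕ.* m ℕ.+ x))) ≡⟨ sumℤ-cong t (λ j _ → sumℤ-cong m (λ x _ → shift j x)) ⟩
    sumℤ t (λ _ → sumℤ m f)                         ≡⟨ sumℤ-const t (sumℤ m f) ⟩
    + t * sumℤ m f                                  ∎
    where
    open ≡-Reasoning
    shift : ∀ j x → f (j ℕ.* m ℕ.+ x) ≡ f x
    shift zero    x = refl
    shift (suc j) x = trans (cong f (ℕP.+-assoc m (j ℕ.* m) x)) (trans (per _) (shift j x))

  sumℤ-agree-except : ∀ n (f g : ℕ → ℤ) j → j ℕ.< n → (∀ i → i ℕ.< n → i ≢ j → f i ≡ g i) →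
    sumℤ n f + g j ≡ sumℤ n g + f j
  sumℤ-agree-except (suc n) f g j j<1+n f≗g with j ℕP.≟ n
  ... | yes refl = trans (cong (λ s → s + f j + g j) (sumℤ-cong n (λ i i<n → f≗g i (ℕP.m<n⇒m<1+n i<n) (ℕP.<⇒≢ i<n))))
                         (xy∙z≈xz∙y (sumℤ n g) (f j) (g j))
  ... | no j≢n = begin
    sumℤ n f + f n + g j  ≡⟨ xy∙z≈xz∙y (sumℤ n f) (f n) (g j) ⟩
    sumℤ n f + g j + f n  ≡⟨ cong₂ _+_ (sumℤ-agree-except n f g j (ℕP.≤∧≢⇒< (ℕP.≤-pred j<1+n) j≢n)
                                          (λ i i<n → f≗g i (ℕP.m<n⇒m<1+n i<n)))
                                       (f≗g n ℕP.≤-refl (j≢n ∘ sym)) ⟩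
    sumℤ n g + f j + g n  ≡⟨ xy∙z≈xz∙y (sumℤ n g) (f j) (g n) ⟩
    sumℤ n g + g n + f j  ∎
    where open ≡-Reasoning

  sumℤ-nonneg : ∀ n (f : ℕ → ℤ) → (∀ i → i ℕ.< n → 0ℤ ≤ f i) → 0ℤ ≤ sumℤ n f
  sumℤ-nonneg zero    f f≥0 = +≤+ ℕ.z≤n
  sumℤ-nonneg (suc n) f f≥0 = +-mono-≤ (sumℤ-nonneg n f (λ i i<n → f≥0 i (ℕP.m<n⇒m<1+n i<n))) (f≥0 n ℕP.≤-refl)

  sumℤ-nonneg≡0⇒≡0 : ∀ n (f : ℕ → ℤ) → (∀ i → i ℕ.< n → 0ℤ ≤ f i) → sumℤ n f ≡ 0ℤ →
    ∀ i → i ℕ.< n → f i ≡ 0ℤ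
  sumℤ-nonneg≡0⇒≡0 (suc n) f f≥0 Σf≡0 i i<1+n = split (i ℕP.≟ n)
    where
    f≥0′ : ∀ i → i ℕ.< n → 0ℤ ≤ f i
    f≥0′ i i<n = f≥0 i (ℕP.m<n⇒m<1+n i<n)
    Σf≥0 : 0ℤ ≤ sumℤ n f
    Σf≥0 = sumℤ-nonneg n f f≥0′
    fn≥0 : 0ℤ ≤ f n
    fn≥0 = f≥0 n ℕP.≤-refl
    summands≡0 : sumℤ n f ≡ 0ℤ × f n ≡ 0ℤ
    summands≡0 = ≤-antisym (subst (sumℤ n f ≤_) Σf≡0 (i≤i+j _ _ {{nonNegative fn≥0}})) Σf≥0
               , ≤-antisym (subst (f n ≤_) Σf≡0 (i≤j+i _ _ {{nonNegative Σf≥0}})) fn≥0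
    split : Dec (i ≡ n) → f i ≡ 0ℤ
    split (yes refl) = proj₂ summands≡0
    split (no i≢n)   = sumℤ-nonneg≡0⇒≡0 n f f≥0′ (proj₁ summands≡0) i (ℕP.≤∧≢⇒< (ℕP.≤-pred i<1+n) i≢n)

  sumℤ-≤∧≡⇒≡ : ∀ n (f g : ℕ → ℤ) → (∀ i → i ℕ.< n → f i ≤ g i) → sumℤ n f ≡ sumℤ n g →
    ∀ i → i ℕ.< n → f i ≡ g i
  sumℤ-≤∧≡⇒≡ n f g f≤g Σf≡Σg i i<n = sym (i-j≡0⇒i≡j (g i) (f i)
    (sumℤ-nonneg≡0⇒≡0 n (λ j → g j - f j) (λ j j<n → i≤j⇒0≤j-i (f≤g j j<n)) Σ[g-f]≡0 i i<n))
    where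
    Σ[g-f]≡0 : sumℤ n (λ j → g j - f j) ≡ 0ℤ
    Σ[g-f]≡0 = trans (sumℤ-sub n g f) (trans (cong (_-_ (sumℤ n g)) Σf≡Σg) (+-inverseʳ (sumℤ n g)))

  sumℤ≢0⇒∃≢0 : ∀ n (f : ℕ → ℤ) → sumℤ n f ≢ 0ℤ → ∃ λ i → i ℕ.< n × f i ≢ 0ℤ
  sumℤ≢0⇒∃≢0 zero    f Σf≢0 = ⊥-elim (Σf≢0 refl)
  sumℤ≢0⇒∃≢0 (suc n) f Σf≢0 with f n ≟ 0ℤ
  ... | no fn≢0 = n , ℕP.≤-refl , fn≢0
  ... | yes fn≡0 =
    let i , i<n , fi≢0 = sumℤ≢0⇒∃≢0 n f (λ Σf≡0 → Σf≢0 (cong₂ _+_ Σf≡0 fn≡0)) in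
    i , ℕP.m<n⇒m<1+n i<n , fi≢0

  δ : ℕ → ℕ → ℤ
  δ zero    zero    = 1ℤ
  δ zero    (suc _) = 0ℤ
  δ (suc _) zero    = 0ℤ
  δ (suc c) (suc y) = δ c y

  δ-refl : ∀ c → δ c c ≡ 1ℤ
  δ-refl zero    = refl
  δ-refl (suc c) = δ-refl c

  δ-≢ : ∀ {c y} → y ≢ c → δ c y ≡ 0ℤ
  δ-≢ {zero}  {zero}  y≢c = ⊥-elim (y≢c refl)
  δ-≢ {zero}  {suc y} y≢c = refl
  δ-≢ {suc c} {zero}  y≢c = refl
  δ-≢ {suc c} {suc y} y≢c = δ-≢ (y≢c ∘ cong suc)

  δ-sym : ∀ c y → δ c y ≡ δ y c
  δ-sym zero    zero    = refl
  δ-sym zero    (suc y) = refl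
  δ-sym (suc c) zero    = refl
  δ-sym (suc c) (suc y) = δ-sym c y

  δ-≡ : ∀ {c y} → y ≡ c → δ c y ≡ 1ℤ
  δ-≡ {c} refl = δ-refl c

  sumℤ-δ : ∀ n {c} → c ℕ.< n → sumℤ n (δ c) ≡ 1ℤ
  sumℤ-δ n {c} c<n = begin
    sumℤ n (δ c)               ≡⟨ +-identityʳ _ ⟨
    sumℤ n (δ c) + 0ℤ          ≡⟨ sumℤ-agree-except n (δ c) (λ _ → 0ℤ) c c<n (λ _ _ → δ-≢) ⟩
    sumℤ n (λ _ → 0ℤ) + δ c c  ≡⟨ cong₂ _+_ (sumℤ-0 n) (δ-refl c) ⟩
    1ℤ                         ∎
    where open ≡-Reasoning

module Reindexing where

  open FiniteSum
  open import Data.Nat using (zero; _<_)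
  import Data.Nat.Properties as ℕP
  open import Data.Fin using (Fin; toℕ; fromℕ<)
  import Data.Fin.Properties as FinP
  open import Data.Integer using (ℤ; _+_; 0ℤ; 1ℤ)
  open import Data.Product using (∃; _×_; _,_; proj₁; proj₂)
  open import Data.Empty using (⊥-elim)
  open import Function using (_∘_)
  open import Relation.Binary.PropositionalEquality
  open import Relation.Nullary using (¬_; yes; no)

  MapsInto : ℕ → (ℕ → ℕ) → Set
  MapsInto n σ = ∀ i → i < n → σ i < n

  InjectiveOn : ℕ → (ℕ → ℕ) → Set
  InjectiveOn n σ = ∀ i j → i < n → j < n → σ i ≡ σ j → i ≡ j

  ¬injectiveOn-into-smaller : ∀ {n σ} → (∀ i → i < suc n → σ i < n) → ¬ InjectiveOn (suc n) σ
  ¬injectiveOn-into-smaller {n} {σ} into inj =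
    let i , j , i<j , fi≡fj = FinP.pigeonhole (ℕP.n<1+n n) f in
    ℕP.<⇒≢ i<j (inj (toℕ i) (toℕ j) (FinP.toℕ<n i) (FinP.toℕ<n j) (begin
      σ (toℕ i)  ≡⟨ FinP.toℕ-fromℕ< _ ⟨
      toℕ (f i)  ≡⟨ cong toℕ fi≡fj ⟩
      toℕ (f j)  ≡⟨ FinP.toℕ-fromℕ< _ ⟩
      σ (toℕ j)  ∎))
    where
    open ≡-Reasoning
    f : Fin (suc n) → Fin n
    f i = fromℕ< (into (toℕ i) (FinP.toℕ<n i))

  _[_≔_] : (ℕ → ℕ) → ℕ → ℕ → ℕ → ℕ
  (σ [ j ≔ v ]) i with i ℕP.≟ j
  ... | yes _ = v
  ... | no  _ = σ i

  [≔]-≡ : ∀ σ j v → (σ [ j ≔ v ]) j ≡ v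
  [≔]-≡ σ j v with j ℕP.≟ j
  ... | yes _   = refl
  ... | no  j≢j = ⊥-elim (j≢j refl)

  [≔]-≢ : ∀ σ {i j} v → i ≢ j → (σ [ j ≔ v ]) i ≡ σ i
  [≔]-≢ σ {i} {j} v i≢j with i ℕP.≟ j
  ... | yes i≡j = ⊥-elim (i≢j i≡j)
  ... | no  _   = refl

  [≔]-restrict : ∀ {n σ j₀} → MapsInto (suc n) σ → InjectiveOn (suc n) σ → j₀ < n → σ j₀ ≡ n →
    MapsInto n (σ [ j₀ ≔ σ n ]) × InjectiveOn n (σ [ j₀ ≔ σ n ])
  [≔]-restrict {n} {σ} {j₀} into inj j₀<n σj₀≡n = into′ , inj′
    where
    hits-n-only-at-j₀ : ∀ {i} → i < suc n → σ i ≡ n → i ≡ j₀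
    hits-n-only-at-j₀ {i} i<1+n σi≡n = inj i j₀ i<1+n (ℕP.m<n⇒m<1+n j₀<n) (trans σi≡n (sym σj₀≡n))
    into′ : MapsInto n (σ [ j₀ ≔ σ n ])
    into′ i i<n with i ℕP.≟ j₀
    ... | yes _    = ℕP.≤∧≢⇒< (ℕP.≤-pred (into n ℕP.≤-refl)) (ℕP.<⇒≢ j₀<n ∘ sym ∘ hits-n-only-at-j₀ ℕP.≤-refl)
    ... | no i≢j₀ = ℕP.≤∧≢⇒< (ℕP.≤-pred (into i (ℕP.m<n⇒m<1+n i<n))) (i≢j₀ ∘ hits-n-only-at-j₀ (ℕP.m<n⇒m<1+n i<n))
    inj′ : InjectiveOn n (σ [ j₀ ≔ σ n ])
    inj′ i j i<n j<n σ′i≡σ′j with i ℕP.≟ j₀ | j ℕP.≟ j₀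
    ... | yes i≡j₀ | yes j≡j₀ = trans i≡j₀ (sym j≡j₀)
    ... | yes _    | no  _    = ⊥-elim (ℕP.<⇒≢ j<n (sym (inj n j ℕP.≤-refl (ℕP.m<n⇒m<1+n j<n) σ′i≡σ′j)))
    ... | no  _    | yes _    = ⊥-elim (ℕP.<⇒≢ i<n (inj i n (ℕP.m<n⇒m<1+n i<n) ℕP.≤-refl σ′i≡σ′j))
    ... | no  _    | no  _    = inj i j (ℕP.m<n⇒m<1+n i<n) (ℕP.m<n⇒m<1+n j<n) σ′i≡σ′j

  injectiveOn-hits-top : ∀ {n σ} → MapsInto (suc n) σ → InjectiveOn (suc n) σ → ∃ λ j → j < suc n × σ j ≡ n
  injectiveOn-hits-top {n} {σ} into inj with FinP.any? (λ (i : Fin (suc n)) → σ (toℕ i) ℕP.≟ n)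
  ... | yes (i , σi≡n) = toℕ i , FinP.toℕ<n i , σi≡n
  ... | no  n∉σ[1+n]  = ⊥-elim (¬injectiveOn-into-smaller into′ inj)
    where
    into′ : ∀ i → i < suc n → σ i < n
    into′ i i<1+n = ℕP.≤∧≢⇒< (ℕP.≤-pred (into i i<1+n))
      (λ σi≡n → n∉σ[1+n] (fromℕ< i<1+n , trans (cong σ (FinP.toℕ-fromℕ< i<1+n)) σi≡n))

  sumℤ-reindex : ∀ n σ → MapsInto n σ → InjectiveOn n σ → ∀ (g : ℕ → ℤ) → sumℤ n (g ∘ σ) ≡ sumℤ n g
  sumℤ-reindex zero    σ into inj g = refl
  sumℤ-reindex (suc n) σ into inj g with injectiveOn-hits-top into inj
  ... | j₀ , j₀<1+n , σj₀≡n with j₀ ℕP.≟ n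
  ...   | yes refl = cong₂ _+_ (sumℤ-reindex n σ into′ inj′ g) (cong g σj₀≡n)
    where
    inj′ : InjectiveOn n σ
    inj′ i j i<n j<n = inj i j (ℕP.m<n⇒m<1+n i<n) (ℕP.m<n⇒m<1+n j<n)
    into′ : MapsInto n σ
    into′ i i<n = ℕP.≤∧≢⇒< (ℕP.≤-pred (into i (ℕP.m<n⇒m<1+n i<n)))
      (λ σi≡n → ℕP.<⇒≢ i<n (inj i j₀ (ℕP.m<n⇒m<1+n i<n) j₀<1+n (trans σi≡n (sym σj₀≡n))))
  ...   | no j₀≢n = begin
    sumℤ n (g ∘ σ) + g (σ n)    ≡⟨ cong (λ k → sumℤ n (g ∘ σ) + g k) ([≔]-≡ σ j₀ (σ n)) ⟨
    sumℤ n (g ∘ σ) + g (σ′ j₀)  ≡⟨ sumℤ-agree-except n (g ∘ σ) (g ∘ σ′) j₀ j₀<n (λ i _ i≢j₀ → cong g (sym ([≔]-≢ σ (σ n) i≢j₀))) ⟩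
    sumℤ n (g ∘ σ′) + g (σ j₀)  ≡⟨ cong₂ _+_ (sumℤ-reindex n σ′ (proj₁ σ′-perm) (proj₂ σ′-perm) g) (cong g σj₀≡n) ⟩
    sumℤ n g + g n              ∎
    where
    open ≡-Reasoning
    j₀<n : j₀ < n
    j₀<n = ℕP.≤∧≢⇒< (ℕP.≤-pred j₀<1+n) j₀≢n
    σ′ : ℕ → ℕ
    σ′ = σ [ j₀ ≔ σ n ]
    σ′-perm : MapsInto n σ′ × InjectiveOn n σ′
    σ′-perm = [≔]-restrict into inj j₀<n σj₀≡n

  injectiveOn⇒surjectiveOn : ∀ n σ → MapsInto n σ → InjectiveOn n σ → ∀ c → c < n → ∃ λ j → j < n × σ j ≡ c
  injectiveOn⇒surjectiveOn n σ into inj c c<n =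
    let j , j<n , δcσj≢0 = sumℤ≢0⇒∃≢0 n (δ c ∘ σ) (λ Σ≡0 → 1≢0 (trans (sym Σδσ≡1) Σ≡0)) in
    j , j<n , δ≢0⇒≡ δcσj≢0
    where
    Σδσ≡1 : sumℤ n (δ c ∘ σ) ≡ 1ℤ
    Σδσ≡1 = trans (sumℤ-reindex n σ into inj (δ c)) (sumℤ-δ n c<n)
    1≢0 : 1ℤ ≢ 0ℤ
    1≢0 ()
    δ≢0⇒≡ : ∀ {y} → δ c y ≢ 0ℤ → y ≡ c
    δ≢0⇒≡ {y} δcy≢0 with y ℕP.≟ c
    ... | yes y≡c = y≡c
    ... | no  y≢c = ⊥-elim (δcy≢0 (δ-≢ y≢c))

module IntegerResidue where

  open import Data.Nat as ℕ using (zero; z<s; _%_)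
  import Data.Nat.Properties as ℕP
  open import Data.Nat.DivMod using ([m+n]%n≡m%n; m<n⇒m%n≡m; n%n≡0)
  open import Data.Nat.Divisibility using (_∣_; divides)
  open import Data.Integer using (+_; -[1+_]; _+_; -_; _%ℕ_; _⊖_)
  open import Data.Integer.Properties using (+-assoc; +-comm; +-identityʳ; pos-+; ⊖-<; ⊖-≥)
  open import Relation.Binary.PropositionalEquality
  open import Relation.Binary.Definitions using (tri<; tri≈; tri>)

  complement : ℕ → ℕ → ℕ
  complement q zero    = 0
  complement q (suc r) = q ℕ.∸ suc r

  -[1+n]%ℕ≡complement : ∀ n q → -[1+ n ] %ℕ suc q ≡ complement (suc q) (suc n % suc q)
  -[1+n]%ℕ≡complement n q with suc n % suc q
  ... | zero  = refl
  ... | suc _ = refl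

  %ℕ-+-period : ∀ i q .{{_ : NonZero q}} → (i + + q) %ℕ q ≡ i %ℕ q
  %ℕ-+-period (+ n)     q       = [m+n]%n≡m%n n q
  %ℕ-+-period -[1+ n ] (suc q) with ℕP.<-cmp (suc n) (suc q)
  ... | tri< n<q _ _
    rewrite ⊖-≥ (ℕP.<⇒≤ n<q) | -[1+n]%ℕ≡complement n q | m<n⇒m%n≡m n<q
    = m<n⇒m%n≡m (ℕP.∸-monoʳ-< {suc q} {suc n} {0} ℕ.z<s (ℕP.<⇒≤ n<q))
  ... | tri≈ _ refl _
    rewrite ⊖-≥ (ℕP.≤-refl {suc n}) | -[1+n]%ℕ≡complement n n | ℕP.n∸n≡0 n
    = cong (complement (suc n)) (sym (n%n≡0 (suc n)))
  ... | tri> _ _ q<n = begin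
    (suc q ⊖ suc n) %ℕ suc q                    ≡⟨ cong (_%ℕ suc q) (trans (⊖-< q<n) (cong (λ k → - + k) (ℕP.+-∸-assoc 1 q<n))) ⟩
    -[1+ n ℕ.∸ suc q ] %ℕ suc q                 ≡⟨ -[1+n]%ℕ≡complement (n ℕ.∸ suc q) q ⟩
    complement (suc q) (suc (n ℕ.∸ suc q) % suc q) ≡⟨ cong (complement (suc q)) shift ⟩
    complement (suc q) (suc n % suc q)          ≡⟨ -[1+n]%ℕ≡complement n q ⟨
    -[1+ n ] %ℕ suc q                           ∎
    where
    open ≡-Reasoning
    shift : suc (n ℕ.∸ suc q) % suc q ≡ suc n % suc q
    shift = trans (sym ([m+n]%n≡m%n (suc (n ℕ.∸ suc q)) (suc q)))
                  (cong (λ k → suc k % suc q) (ℕP.m∸n+n≡m (ℕP.≤-pred q<n)))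

  %ℕ-+-multiple : ∀ i t q .{{_ : NonZero q}} → (i + + (t ℕ.* q)) %ℕ q ≡ i %ℕ q
  %ℕ-+-multiple i zero    q = cong (_%ℕ q) (+-identityʳ i)
  %ℕ-+-multiple i (suc t) q = begin
    (i + + (q ℕ.+ t ℕ.* q)) %ℕ q  ≡⟨ cong (_%ℕ q) regroup ⟩
    (i + + (t ℕ.* q) + + q) %ℕ q  ≡⟨ %ℕ-+-period (i + + (t ℕ.* q)) q ⟩
    (i + + (t ℕ.* q)) %ℕ q        ≡⟨ %ℕ-+-multiple i t q ⟩
    i %ℕ q                        ∎
    where
    open ≡-Reasoning
    regroup : i + + (q ℕ.+ t ℕ.* q) ≡ i + + (t ℕ.* q) + + q
    regroup = trans (cong (_+_ i) (trans (pos-+ q (t ℕ.* q)) (+-comm (+ q) (+ (t ℕ.* q))))) (sym (+-assoc i _ _))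

  %ℕ-via-ℕ : ∀ i t z q .{{_ : NonZero q}} → i + + (t ℕ.* q) ≡ + z → i %ℕ q ≡ z % q
  %ℕ-via-ℕ i t z q i+tq≡z = trans (sym (%ℕ-+-multiple i t q)) (cong (_%ℕ q) i+tq≡z)

  %ℕ-+-*-∣ : ∀ i t {d m} .{{_ : NonZero d}} → d ∣ m → (i + + (t ℕ.* m)) %ℕ d ≡ i %ℕ d
  %ℕ-+-*-∣ i t {d} (divides k refl) =
    trans (cong (λ x → (i + + x) %ℕ d) (sym (ℕP.*-assoc t k d))) (%ℕ-+-multiple i (t ℕ.* k) d)

module Congruence (p : ℕ) .{{_ : NonZero p}} where

  open import Data.Nat using (suc; >-nonZero⁻¹; _+_; _*_; _∸_; _%_; _≤_; _<_)
  import Data.Nat.Properties as ℕP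
  open import Data.Nat.DivMod
    using (%-distribˡ-+; %-distribˡ-*; %-remove-+ʳ; [m+kn]%n≡m%n; m%n%n≡m%n; m%n<n; m<n⇒m%n≡m)
  open import Data.Nat.Divisibility using (_∣_; m%n≡0⇒n∣m)
  open import Data.Nat.Coprimality using (Coprime; coprime-divisor)
  open import Data.Nat.Tactic.RingSolver using (solve-∀)
  open import Data.Integer using (ℤ)
  open import Data.Sum using (inj₁; inj₂)
  open import Relation.Binary.PropositionalEquality
  open FiniteSum
  open Reindexing

  infix 4 _≋_
  _≋_ : ℕ → ℕ → Set
  a ≋ b = a % p ≡ b % p

  ≋-+ : ∀ {a b c d} → a ≋ b → c ≋ d → a + c ≋ b + d
  ≋-+ {a} {b} {c} {d} a≋b c≋d =
    trans (%-distribˡ-+ a c p) (trans (cong₂ (λ x y → (x + y) % p) a≋b c≋d) (sym (%-distribˡ-+ b d p)))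

  ≋-* : ∀ {a b c d} → a ≋ b → c ≋ d → a * c ≋ b * d
  ≋-* {a} {b} {c} {d} a≋b c≋d =
    trans (%-distribˡ-* a c p) (trans (cong₂ (λ x y → (x * y) % p) a≋b c≋d) (sym (%-distribˡ-* b d p)))

  %-≋ : ∀ a → a % p ≋ a
  %-≋ a = m%n%n≡m%n a p

  +-*-≋ : ∀ a t → a + t * p ≋ a
  +-*-≋ a t = [m+kn]%n≡m%n a t p

  -- adding x * (p ∸ 1) is subtracting x
  +-cancelˡ-≋ : ∀ x {y z} → x + y ≋ x + z → y ≋ z
  +-cancelˡ-≋ x {y} {z} x+y≋x+z = begin
    y % p                       ≡⟨ +-*-≋ y x ⟨
    (y + x * p) % p             ≡⟨ cong (_% p) (regroup y) ⟩
    (x + y + x * (p ∸ 1)) % p   ≡⟨ ≋-+ {x + y} {x + z} {x * (p ∸ 1)} x+y≋x+z refl ⟩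
    (x + z + x * (p ∸ 1)) % p   ≡⟨ cong (_% p) (regroup z) ⟨
    (z + x * p) % p             ≡⟨ +-*-≋ z x ⟩
    z % p                       ∎
    where
    open ≡-Reasoning
    regroup : ∀ y → y + x * p ≡ x + y + x * (p ∸ 1)
    regroup y = begin
      y + x * p                ≡⟨ cong (λ q → y + x * q) (ℕP.suc-pred p) ⟨
      y + x * suc (p ∸ 1)      ≡⟨ cong (y +_) (ℕP.*-suc x (p ∸ 1)) ⟩
      y + (x + x * (p ∸ 1))    ≡⟨ shuffle x y (x * (p ∸ 1)) ⟩
      x + y + x * (p ∸ 1)      ∎
      where
      shuffle : ∀ a b c → b + (a + c) ≡ a + b + c
      shuffle = solve-∀

  ≋⇒∣∸ : ∀ {a b} → a ≤ b → a ≋ b → p ∣ b ∸ a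
  ≋⇒∣∸ {a} {b} a≤b a≋b = m%n≡0⇒n∣m (b ∸ a) p (trans (+-cancelˡ-≋ a a+[b∸a]≋a+0) (m<n⇒m%n≡m (>-nonZero⁻¹ p)))
    where
    a+[b∸a]≋a+0 : a + (b ∸ a) ≋ a + 0
    a+[b∸a]≋a+0 = trans (cong (_% p) (ℕP.m+[n∸m]≡n a≤b)) (trans (sym a≋b) (cong (_% p) (sym (ℕP.+-identityʳ a))))

  ∣∸⇒≋ : ∀ {a b} → a ≤ b → p ∣ b ∸ a → a ≋ b
  ∣∸⇒≋ {a} {b} a≤b p∣b∸a = trans (sym (%-remove-+ʳ a p∣b∸a)) (cong (_% p) (ℕP.m+[n∸m]≡n a≤b))

  ≋∧<⇒≡ : ∀ {a b} → a < p → b < p → a ≋ b → a ≡ b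
  ≋∧<⇒≡ a<p b<p a≋b = trans (sym (m<n⇒m%n≡m a<p)) (trans a≋b (m<n⇒m%n≡m b<p))

  *-cancelˡ-≋ : ∀ {u y z} → Coprime p u → u * y ≋ u * z → y ≋ z
  *-cancelˡ-≋ {u} {y} {z} p⊥u uy≋uz with ℕP.≤-total y z
  ... | inj₁ y≤z = ∣∸⇒≋ y≤z (coprime-divisor p⊥u
        (subst (p ∣_) (sym (ℕP.*-distribˡ-∸ u z y)) (≋⇒∣∸ (ℕP.*-monoʳ-≤ u y≤z) uy≋uz)))
  ... | inj₂ z≤y = sym (∣∸⇒≋ z≤y (coprime-divisor p⊥u
        (subst (p ∣_) (sym (ℕP.*-distribˡ-∸ u y z)) (≋⇒∣∸ (ℕP.*-monoʳ-≤ u z≤y) (sym uy≋uz)))))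

  sumℤ-reindex-affine : ∀ x {u} → Coprime p u → ∀ (g : ℕ → ℤ) →
    sumℤ p (λ j → g ((x + u * j) % p)) ≡ sumℤ p g
  sumℤ-reindex-affine x {u} p⊥u g = sumℤ-reindex p (λ j → (x + u * j) % p) (λ j _ → m%n<n _ p)
    (λ i j i<p j<p e → ≋∧<⇒≡ i<p j<p (*-cancelˡ-≋ p⊥u (+-cancelˡ-≋ x e))) g

module ResidueSymbols where

  open import Data.Nat as ℕ using (zero; suc; _%_; _≡ᵇ_)
  open import Data.Integer using (ℤ; +_; -_; _%ℕ_)
  open import Data.Bool using (Bool; if_then_else_)
  open import Data.List using (upTo)
  open import Data.Bool.ListAction using (any)
  open import Relation.Binary.PropositionalEquality

  isSquareRootOf : ℕ → ℕ → ℕ → Bool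
  isSquareRootOf k r x = ((x ℕ.* x) % suc (suc k)) ≡ᵇ r

  legendreOfResidue : ℕ → ℕ → ℤ
  legendreOfResidue k zero      = + 0
  legendreOfResidue k r@(suc _) =
    if any (isSquareRootOf k r) (upTo (suc (suc k))) then + 1 else - (+ 1)

  legendre≡legendreOfResidue : ∀ i k → legendre i k ≡ legendreOfResidue k (i %ℕ suc (suc k))
  legendre≡legendreOfResidue i k with i %ℕ suc (suc k)
  ... | zero  = refl
  ... | suc _ = refl

  legendre-cong : ∀ i j k → i %ℕ suc (suc k) ≡ j %ℕ suc (suc k) → legendre i k ≡ legendre j k
  legendre-cong i j k i≡j = trans (legendre≡legendreOfResidue i k)
    (trans (cong (legendreOfResidue k) i≡j) (sym (legendre≡legendreOfResidue j k)))

  kron2OfResidue : ℕ → ℤ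
  kron2OfResidue 1 = + 1
  kron2OfResidue 7 = + 1
  kron2OfResidue 3 = - (+ 1)
  kron2OfResidue 5 = - (+ 1)
  kron2OfResidue _ = + 0

  kron2≡kron2OfResidue : ∀ i → kron2 i ≡ kron2OfResidue (i %ℕ 8)
  kron2≡kron2OfResidue i with i %ℕ 8
  ... | 0 = refl
  ... | 1 = refl
  ... | 2 = refl
  ... | 3 = refl
  ... | 4 = refl
  ... | 5 = refl
  ... | 6 = refl
  ... | 7 = refl
  ... | suc (suc (suc (suc (suc (suc (suc (suc _))))))) = refl

  kron2-cong : ∀ i j → i %ℕ 8 ≡ j %ℕ 8 → kron2 i ≡ kron2 j
  kron2-cong i j i≡j = trans (kron2≡kron2OfResidue i)
    (trans (cong kron2OfResidue i≡j) (sym (kron2≡kron2OfResidue j)))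

-- p = 3 + k, so that χ below is legendre at the offset suc k used in Defs
module LegendreSymbol {k : ℕ} (p-prime : Prime (suc (suc (suc k)))) where

  open import Data.Nat as ℕ using (zero; z≤n; s≤s; z<s; _+_; _*_; _∸_; _%_; _≤_; _<_)
  import Data.Nat.Properties as ℕP
  open import Data.Nat.DivMod using (%-distribˡ-*; m%n<n; m<n⇒m%n≡m)
  open import Data.Nat.Divisibility using (_∣_; _∣?_; divides; m%n≡0⇒n∣m; n∣m⇒m%n≡0; ∣n⇒∣m*n; ∣⇒≤)
  open import Data.Nat.Primality using (euclidsLemma; prime⇒irreducible)
  open import Data.Nat.Coprimality using (Coprime)
  import Data.Nat.Tactic.RingSolver as ℕ-Solver
  open import Algebra.Properties.CommutativeSemigroup ℕP.*-commutativeSemigroup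
    using (x∙yz≈y∙xz) renaming (interchange to *-interchange)
  open import Data.Integer as ℤ using (ℤ; +_; 0ℤ; 1ℤ; -1ℤ; _%ℕ_)
  import Data.Integer.Properties as ℤP
  open import Algebra.Properties.AbelianGroup ℤP.+-0-abelianGroup using (inverseˡ-unique) renaming (∙-cancelˡ to +-cancelˡ)
  open import Data.Integer.DivMod using (n%ℕd<d)
  open import Data.Bool using (true; false; if_then_else_)
  open import Data.Bool.Properties using (T-≡)
  open import Data.Bool.ListAction using (any)
  open import Data.List using (upTo)
  open import Data.List.Relation.Unary.Any.Properties using (any⁺; any⁻)
  open import Data.List.Membership.Propositional using (find; lose)
  open import Data.List.Membership.Propositional.Properties using (∈-upTo⁺; ∈-upTo⁻)
  open import Data.Product using (∃; _×_; _,_; proj₁; proj₂)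
  open import Data.Sum using (_⊎_; inj₁; inj₂; [_,_]′)
  open import Data.Empty using (⊥-elim)
  open import Function using (_∘_; Equivalence)
  open import Relation.Binary.PropositionalEquality
  open import Relation.Nullary using (yes; no)

  p : ℕ
  p = suc (suc (suc k))

  open Congruence p
  open FiniteSum
  open Reindexing
  open ResidueSymbols

  χ : ℕ → ℤ
  χ n = legendre (+ n) (suc k)

  χ-cong : ∀ {a b} → a ≋ b → χ a ≡ χ b
  χ-cong {a} {b} = legendre-cong (+ a) (+ b) (suc k)

  χ-% : ∀ a → χ (a % p) ≡ χ a
  χ-% a = χ-cong {a % p} {a} (%-≋ a)

  legendre≡χ-%ℕ : ∀ i → legendre i (suc k) ≡ χ (i %ℕ p)
  legendre≡χ-%ℕ i = legendre-cong i (+ (i %ℕ p)) (suc k) (sym (m<n⇒m%n≡m (n%ℕd<d i p)))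

  p-odd : ¬ 2 ∣ p
  p-odd 2∣p with prime⇒irreducible p-prime 2∣p
  ... | inj₁ ()
  ... | inj₂ ()

  ∤-* : ∀ {a b} → ¬ p ∣ a → ¬ p ∣ b → ¬ p ∣ a * b
  ∤-* p∤a p∤b p∣ab = [ p∤a , p∤b ]′ (euclidsLemma _ _ p-prime p∣ab)

  ∣∧<⇒≡0 : ∀ {x} → p ∣ x → x < p → x ≡ 0
  ∣∧<⇒≡0 {zero}  _   _   = refl
  ∣∧<⇒≡0 {suc x} p∣x x<p = ⊥-elim (ℕP.<⇒≱ x<p (∣⇒≤ p∣x))

  ∤-nonzero-residue : ∀ {x} → 0 < x → x < p → ¬ p ∣ x
  ∤-nonzero-residue 0<x x<p p∣x = ℕP.<⇒≢ 0<x (sym (∣∧<⇒≡0 p∣x x<p))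

  ∤⇒coprime : ∀ {u} → ¬ p ∣ u → Coprime p u
  ∤⇒coprime p∤u (d∣p , d∣u) with prime⇒irreducible p-prime d∣p
  ... | inj₁ d≡1 = d≡1
  ... | inj₂ refl = ⊥-elim (p∤u d∣u)

  data Residuosity (n : ℕ) : Set where
    divisible  : p ∣ n → χ n ≡ 0ℤ → Residuosity n
    residue    : ¬ p ∣ n → χ n ≡ 1ℤ → ∀ x → x < p → x * x ≋ n → Residuosity n
    nonresidue : ¬ p ∣ n → χ n ≡ -1ℤ → (∀ x → ¬ x * x ≋ n) → Residuosity n

  χ≡legendreOfResidue : ∀ {n r} → n % p ≡ r → χ n ≡ legendreOfResidue (suc k) r
  χ≡legendreOfResidue {n} n%p≡r = trans (legendre≡legendreOfResidue (+ n) (suc k)) (cong (legendreOfResidue (suc k)) n%p≡r)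

  %≡suc⇒∤ : ∀ {n r} → n % p ≡ suc r → ¬ p ∣ n
  %≡suc⇒∤ {n} n%p≡1+r p∣n = ℕP.0≢1+n (trans (sym (n∣m⇒m%n≡0 n p p∣n)) n%p≡1+r)

  residuosity : ∀ n → Residuosity n
  residuosity n with n % p in n%p≡r
  ... | zero  = divisible (m%n≡0⇒n∣m n p n%p≡r) (χ≡legendreOfResidue {n} n%p≡r)
  ... | suc r with any (isSquareRootOf (suc k) (suc r)) (upTo p) in found
  ...   | true with find (any⁻ (isSquareRootOf (suc k) (suc r)) (upTo p) (Equivalence.from T-≡ found))
  ...     | x , x∈upTo , x²≡r =
    residue (%≡suc⇒∤ n%p≡r) (trans (χ≡legendreOfResidue {n} n%p≡r) (cong (if_then + 1 else ℤ.- + 1) found))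
            x (∈-upTo⁻ x∈upTo) (trans (ℕP.≡ᵇ⇒≡ _ _ x²≡r) (sym n%p≡r))
  residuosity n | suc r | false =
    nonresidue (%≡suc⇒∤ n%p≡r) (trans (χ≡legendreOfResidue {n} n%p≡r) (cong (if_then + 1 else ℤ.- + 1) found)) no-root
    where
    no-root : ∀ x → ¬ x * x ≋ n
    no-root x x²≋n with () ← trans (sym found) (Equivalence.to T-≡ (any⁺ (isSquareRootOf (suc k) (suc r))
      (lose (∈-upTo⁺ (m%n<n x p)) (ℕP.≡⇒≡ᵇ _ _ (trans (sym (%-distribˡ-* x x p)) (trans x²≋n n%p≡r))))))

  χ-∣ : ∀ {n} → p ∣ n → χ n ≡ 0ℤ
  χ-∣ {n} p∣n with residuosity n
  ... | divisible  _   χn≡0     = χn≡0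
  ... | residue    p∤n _ _ _ _  = ⊥-elim (p∤n p∣n)
  ... | nonresidue p∤n _ _      = ⊥-elim (p∤n p∣n)

  χ-square : ∀ {n} x → ¬ p ∣ n → x * x ≋ n → χ n ≡ 1ℤ
  χ-square {n} x p∤n x²≋n with residuosity n
  ... | divisible  p∣n _         = ⊥-elim (p∤n p∣n)
  ... | residue    _ χn≡1 _ _ _  = χn≡1
  ... | nonresidue _ _ no-root   = ⊥-elim (no-root x x²≋n)

  χ-∤ : ∀ {n} → ¬ p ∣ n → χ n ≡ 1ℤ ⊎ χ n ≡ -1ℤ
  χ-∤ {n} p∤n with residuosity n
  ... | divisible  p∣n _         = ⊥-elim (p∤n p∣n)
  ... | residue    _ χn≡1 _ _ _  = inj₁ χn≡1
  ... | nonresidue _ χn≡-1 _     = inj₂ χn≡-1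

  -1≤χ : ∀ n → -1ℤ ℤ.≤ χ n
  -1≤χ n with residuosity n
  ... | divisible  _ χn≡0       rewrite χn≡0  = ℤ.-≤+
  ... | residue    _ χn≡1 _ _ _ rewrite χn≡1  = ℤ.-≤+
  ... | nonresidue _ χn≡-1 _    rewrite χn≡-1 = ℤP.≤-refl

  χ≤1 : ∀ n → χ n ℤ.≤ 1ℤ
  χ≤1 n with residuosity n
  ... | divisible  _ χn≡0       rewrite χn≡0  = ℤ.+≤+ z≤n
  ... | residue    _ χn≡1 _ _ _ rewrite χn≡1  = ℤP.≤-refl
  ... | nonresidue _ χn≡-1 _    rewrite χn≡-1 = ℤ.-≤+

  χ²≡1 : ∀ {n} → ¬ p ∣ n → χ n ℤ.* χ n ≡ 1ℤ
  χ²≡1 p∤n with χ-∤ p∤n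
  ... | inj₁ χn≡1  rewrite χn≡1  = refl
  ... | inj₂ χn≡-1 rewrite χn≡-1 = refl

  χ²≡1-δ : ∀ n → χ n ℤ.* χ n ≡ 1ℤ ℤ.- δ 0 (n % p)
  χ²≡1-δ n with residuosity n
  ... | divisible  p∣n χn≡0     rewrite χn≡0 | n∣m⇒m%n≡0 n p p∣n = refl
  ... | residue    p∤n _ _ _ _  rewrite χ²≡1 p∤n | δ-≢ (p∤n ∘ m%n≡0⇒n∣m n p) = refl
  ... | nonresidue p∤n _ _      rewrite χ²≡1 p∤n | δ-≢ (p∤n ∘ m%n≡0⇒n∣m n p) = refl

  χ³≡χ : ∀ n → χ n ℤ.* (χ n ℤ.* χ n) ≡ χ n
  χ³≡χ n with residuosity n
  ... | divisible  _ χn≡0       rewrite χn≡0  = refl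
  ... | residue    _ χn≡1 _ _ _ rewrite χn≡1  = refl
  ... | nonresidue _ χn≡-1 _    rewrite χn≡-1 = refl

  ∣∧<2p⇒≡p : ∀ {m} → p ∣ m → 0 < m → m < p + p → m ≡ p
  ∣∧<2p⇒≡p (divides zero refl)          ()  _
  ∣∧<2p⇒≡p (divides 1 refl)             _   _    = ℕP.+-identityʳ p
  ∣∧<2p⇒≡p (divides (suc (suc q)) refl) _   m<2p =
    ⊥-elim (ℕP.<⇒≱ m<2p (ℕP.+-monoʳ-≤ p (ℕP.m≤m+n p (q * p))))

  difference-of-squares : ∀ {a b} → a ≤ b → b * b ∸ a * a ≡ (b ∸ a) * (b + a)
  difference-of-squares {a} {b} a≤b with b ∸ a | ℕP.m+[n∸m]≡n a≤b
  ... | d | refl = trans (cong (_∸ a * a) (expand a d)) (ℕP.m+n∸n≡m _ (a * a))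
    where
    expand : ∀ a d → (a + d) * (a + d) ≡ d * ((a + d) + a) + a * a
    expand = ℕ-Solver.solve-∀

  ≤∧²≋²⇒≡∨+≡p : ∀ {a b} → a ≤ b → b < p → 0 < b → a * a ≋ b * b → a ≡ b ⊎ a + b ≡ p
  ≤∧²≋²⇒≡∨+≡p {a} {b} a≤b b<p 0<b a²≋b² with euclidsLemma (b ∸ a) (b + a) p-prime p∣[b∸a][b+a]
    where
    p∣[b∸a][b+a] : p ∣ (b ∸ a) * (b + a)
    p∣[b∸a][b+a] = subst (p ∣_) (difference-of-squares a≤b) (≋⇒∣∸ (ℕP.*-mono-≤ a≤b a≤b) a²≋b²)
  ... | inj₁ p∣b∸a = inj₁ (ℕP.≤-antisym a≤b (ℕP.m∸n≡0⇒m≤n (∣∧<⇒≡0 p∣b∸a (ℕP.≤-<-trans (ℕP.m∸n≤m b a) b<p))))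
  ... | inj₂ p∣b+a = inj₂ (trans (ℕP.+-comm a b) (∣∧<2p⇒≡p p∣b+a (ℕP.<-≤-trans 0<b (ℕP.m≤m+n b a))
                          (ℕP.+-mono-< b<p (ℕP.≤-<-trans a≤b b<p))))

  ²≋²⇒≡∨+≡p : ∀ {x y} → x < p → y < p → 0 < y → x * x ≋ y * y → x ≡ y ⊎ x + y ≡ p
  ²≋²⇒≡∨+≡p {x} {y} x<p y<p 0<y x²≋y² with ℕP.≤-total x y
  ... | inj₁ x≤y = ≤∧²≋²⇒≡∨+≡p x≤y y<p 0<y x²≋y²
  ... | inj₂ y≤x with ≤∧²≋²⇒≡∨+≡p y≤x x<p (ℕP.<-≤-trans 0<y y≤x) (sym x²≋y²)
  ...   | inj₁ y≡x   = inj₁ (sym y≡x)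
  ...   | inj₂ y+x≡p = inj₂ (trans (ℕP.+-comm x y) y+x≡p)

  [p∸x]²≋x² : ∀ {x} → x ≤ p → (p ∸ x) * (p ∸ x) ≋ x * x
  [p∸x]²≋x² {x} x≤p with p ∸ x | ℕP.m+[n∸m]≡n x≤p
  ... | y | x+y≡p = begin
    (y * y) % p                  ≡⟨ +-*-≋ (y * y) x ⟨
    (y * y + x * p) % p          ≡⟨ cong (λ q → (y * y + x * q) % p) (sym x+y≡p) ⟩
    (y * y + x * (x + y)) % p    ≡⟨ cong (_% p) (swap x y) ⟩
    (x * x + y * (x + y)) % p    ≡⟨ cong (λ q → (x * x + y * q) % p) x+y≡p ⟩
    (x * x + y * p) % p          ≡⟨ +-*-≋ (x * x) y ⟩
    (x * x) % p                  ∎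
    where
    open ≡-Reasoning
    swap : ∀ a b → b * b + a * (a + b) ≡ a * a + b * (a + b)
    swap = ℕ-Solver.solve-∀

  #square-roots≡1+χ : ∀ n → sumℤ p (λ x → δ (n % p) ((x * x) % p)) ≡ 1ℤ ℤ.+ χ n
  #square-roots≡1+χ n with residuosity n
  ... | divisible p∣n χn≡0 = begin
    sumℤ p (λ x → δ (n % p) ((x * x) % p))  ≡⟨ sumℤ-cong p only-root-0 ⟩
    sumℤ p (δ 0)                            ≡⟨ sumℤ-δ p z<s ⟩
    1ℤ                                      ≡⟨ cong (ℤ._+_ 1ℤ) χn≡0 ⟨
    1ℤ ℤ.+ χ n                              ∎
    where
    open ≡-Reasoning
    only-root-0 : ∀ x → x < p → δ (n % p) ((x * x) % p) ≡ δ 0 x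
    only-root-0 zero    _   rewrite n∣m⇒m%n≡0 n p p∣n = refl
    only-root-0 (suc x) x<p rewrite n∣m⇒m%n≡0 n p p∣n = δ-≢ p∤x²
      where
      p∤x² : (suc x * suc x) % p ≢ 0
      p∤x² x²%p≡0 = ∤-* p∤x p∤x (m%n≡0⇒n∣m _ p x²%p≡0)
        where p∤x = ∤-nonzero-residue z<s x<p
  ... | nonresidue _ χn≡-1 no-root = begin
    sumℤ p (λ x → δ (n % p) ((x * x) % p))  ≡⟨ sumℤ-cong p (λ x _ → δ-≢ (no-root x)) ⟩
    sumℤ p (λ _ → 0ℤ)                       ≡⟨ sumℤ-0 p ⟩
    0ℤ                                      ≡⟨ cong (ℤ._+_ 1ℤ) χn≡-1 ⟨
    1ℤ ℤ.+ χ n                              ∎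
    where open ≡-Reasoning
  ... | residue p∤n χn≡1 x₀ x₀<p x₀²≋n = begin
    sumℤ p (λ x → δ (n % p) ((x * x) % p))  ≡⟨ sumℤ-cong p two-roots ⟩
    sumℤ p (λ x → δ x₀ x ℤ.+ δ x₁ x)        ≡⟨ sumℤ-+ p (δ x₀) (δ x₁) ⟩
    sumℤ p (δ x₀) ℤ.+ sumℤ p (δ x₁)         ≡⟨ cong₂ ℤ._+_ (sumℤ-δ p x₀<p) (trans (sumℤ-δ p x₁<p) (sym χn≡1)) ⟩
    1ℤ ℤ.+ χ n                              ∎
    where
    open ≡-Reasoning
    x₁ : ℕ
    x₁ = p ∸ x₀
    0<x₀ : 0 < x₀
    0<x₀ = ℕP.n≢0⇒n>0 (λ { refl → p∤n (m%n≡0⇒n∣m n p (sym x₀²≋n)) })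
    x₁<p : x₁ < p
    x₁<p = ℕP.∸-monoʳ-< 0<x₀ (ℕP.<⇒≤ x₀<p)
    x₀≢x₁ : x₀ ≢ x₁
    x₀≢x₁ x₀≡x₁ = p-odd (divides x₀ (begin
      p              ≡⟨ ℕP.m+[n∸m]≡n (ℕP.<⇒≤ x₀<p) ⟨
      x₀ + x₁        ≡⟨ cong (_+_ x₀) x₀≡x₁ ⟨
      x₀ + x₀        ≡⟨ cong (_+_ x₀) (ℕP.+-identityʳ x₀) ⟨
      2 * x₀         ≡⟨ ℕP.*-comm 2 x₀ ⟩
      x₀ * 2         ∎))
    two-roots : ∀ x → x < p → δ (n % p) ((x * x) % p) ≡ δ x₀ x ℤ.+ δ x₁ x
    two-roots x x<p with x ℕP.≟ x₀ | x ℕP.≟ x₁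
    ... | yes x≡x₀ | yes x≡x₁ = ⊥-elim (x₀≢x₁ (trans (sym x≡x₀) x≡x₁))
    ... | yes refl | no x≢x₁  = trans (δ-≡ x₀²≋n) (sym (cong₂ ℤ._+_ (δ-refl x) (δ-≢ x≢x₁)))
    ... | no x≢x₀  | yes refl = trans (δ-≡ (trans ([p∸x]²≋x² (ℕP.<⇒≤ x₀<p)) x₀²≋n)) (sym (cong₂ ℤ._+_ (δ-≢ x≢x₀) (δ-refl x)))
    ... | no x≢x₀  | no x≢x₁  = trans (δ-≢ not-root) (sym (cong₂ ℤ._+_ (δ-≢ x≢x₀) (δ-≢ x≢x₁)))
      where
      not-root : ¬ x * x ≋ n
      not-root x²≋n with ²≋²⇒≡∨+≡p x<p x₀<p 0<x₀ (trans x²≋n (sym x₀²≋n))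
      ... | inj₁ x≡x₀   = x≢x₀ x≡x₀
      ... | inj₂ x+x₀≡p = x≢x₁ (trans (sym (ℕP.m+n∸n≡m x x₀)) (cong (_∸ x₀) x+x₀≡p))

  -- counting the pairs (n, x) with x² ≡ n in two ways
  sumℤ-χ : sumℤ p χ ≡ 0ℤ
  sumℤ-χ = +-cancelˡ (+ p) (sumℤ p χ) 0ℤ (begin
    + p ℤ.+ sumℤ p χ                                    ≡⟨ cong (ℤ._+ sumℤ p χ) Σ1≡p ⟨
    sumℤ p (λ _ → 1ℤ) ℤ.+ sumℤ p χ                      ≡⟨ sumℤ-+ p (λ _ → 1ℤ) χ ⟨
    sumℤ p (λ n → 1ℤ ℤ.+ χ n)                           ≡⟨ sumℤ-cong p count-roots ⟨
    sumℤ p (λ n → sumℤ p (λ x → δ n ((x * x) % p)))     ≡⟨ sumℤ-comm p p (λ n x → δ n ((x * x) % p)) ⟩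
    sumℤ p (λ x → sumℤ p (λ n → δ n ((x * x) % p)))     ≡⟨ sumℤ-cong p (λ x _ → one-square x) ⟩
    sumℤ p (λ _ → 1ℤ)                                   ≡⟨ Σ1≡p ⟩
    + p                                                 ≡⟨ ℤP.+-identityʳ (+ p) ⟨
    + p ℤ.+ 0ℤ                                          ∎)
    where
    open ≡-Reasoning
    Σ1≡p : sumℤ p (λ _ → 1ℤ) ≡ + p
    Σ1≡p = trans (sumℤ-const p 1ℤ) (ℤP.*-identityʳ (+ p))
    count-roots : ∀ n → n < p → sumℤ p (λ x → δ n ((x * x) % p)) ≡ 1ℤ ℤ.+ χ n
    count-roots n n<p = trans (cong (λ c → sumℤ p (λ x → δ c ((x * x) % p))) (sym (m<n⇒m%n≡m n<p)))
                              (#square-roots≡1+χ n)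
    one-square : ∀ x → sumℤ p (λ n → δ n ((x * x) % p)) ≡ 1ℤ
    one-square x = trans (sumℤ-cong p (λ n _ → δ-sym n _)) (sumℤ-δ p (m%n<n (x * x) p))

  sumℤ-χ-*ˡ : ∀ {b} → ¬ p ∣ b → sumℤ p (λ c → χ (b * c)) ≡ 0ℤ
  sumℤ-χ-*ˡ {b} p∤b = trans (sumℤ-cong p (λ c _ → sym (χ-% (b * c))))
    (trans (sumℤ-reindex-affine 0 (∤⇒coprime p∤b) χ) sumℤ-χ)

  χ-*-% : ∀ b c → χ (b * c) ≡ χ (b * (c % p))
  χ-*-% b c = χ-cong {b * c} {b * (c % p)} (≋-* {b} {b} {c} {c % p} refl (sym (%-≋ c)))

  -- both sides sum to 0 over a period, and the left one dominates pointwise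
  χ-*-residueˡ : ∀ {b} y → ¬ p ∣ b → y * y ≋ b → ∀ c → χ (b * c) ≡ χ c
  χ-*-residueˡ {b} y p∤b y²≋b c = begin
    χ (b * c)        ≡⟨ χ-*-% b c ⟩
    χ (b * (c % p))  ≡⟨ sumℤ-≤∧≡⇒≡ p χ (λ c → χ (b * c)) χ≤χ[b*] Σχ≡Σχ[b*] (c % p) (m%n<n c p) ⟨
    χ (c % p)        ≡⟨ χ-% c ⟩
    χ c              ∎
    where
    open ≡-Reasoning
    χ≤χ[b*] : ∀ c → c < p → χ c ℤ.≤ χ (b * c)
    χ≤χ[b*] c _ with residuosity c
    ... | divisible  p∣c χc≡0         rewrite χc≡0 | χ-∣ (∣n⇒∣m*n b p∣c) = ℤP.≤-refl
    ... | nonresidue _   χc≡-1 _      rewrite χc≡-1 = -1≤χ (b * c)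
    ... | residue    p∤c χc≡1 x _ x²≋c
      rewrite χc≡1 | χ-square {b * c} (y * x) (∤-* p∤b p∤c) (trans (cong (_% p) (*-interchange y x y x)) (≋-* {y * y} {b} {x * x} {c} y²≋b x²≋c))
      = ℤP.≤-refl
    Σχ≡Σχ[b*] : sumℤ p χ ≡ sumℤ p (λ c → χ (b * c))
    Σχ≡Σχ[b*] = trans sumℤ-χ (sym (sumℤ-χ-*ˡ p∤b))

  χ-*-nonresidueˡ : ∀ {b} → ¬ p ∣ b → χ b ≡ -1ℤ → ∀ c → χ (b * c) ≡ ℤ.- χ c
  χ-*-nonresidueˡ {b} p∤b χb≡-1 c = begin
    χ (b * c)          ≡⟨ χ-*-% b c ⟩
    χ (b * (c % p))    ≡⟨ sumℤ-≤∧≡⇒≡ p (λ c → χ (b * c)) (λ c → ℤ.- χ c) χ[b*]≤-χ Σχ[b*]≡Σ-χ (c % p) (m%n<n c p) ⟩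
    ℤ.- χ (c % p)      ≡⟨ cong ℤ.-_ (χ-% c) ⟩
    ℤ.- χ c            ∎
    where
    open ≡-Reasoning
    χ[b*]≤-χ : ∀ c → c < p → χ (b * c) ℤ.≤ ℤ.- χ c
    χ[b*]≤-χ c _ with residuosity c
    ... | divisible  p∣c χc≡0         rewrite χc≡0 | χ-∣ (∣n⇒∣m*n b p∣c) = ℤP.≤-refl
    ... | nonresidue _   χc≡-1 _      rewrite χc≡-1 = χ≤1 (b * c)
    ... | residue    p∤c χc≡1 x _ x²≋c
      rewrite χc≡1 | ℕP.*-comm b c | χ-*-residueˡ x p∤c x²≋c b | χb≡-1 = ℤP.≤-refl
    Σχ[b*]≡Σ-χ : sumℤ p (λ c → χ (b * c)) ≡ sumℤ p (λ c → ℤ.- χ c)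
    Σχ[b*]≡Σ-χ = trans (sumℤ-χ-*ˡ p∤b) (sym (trans (sumℤ-neg p χ) (cong ℤ.-_ sumℤ-χ)))

  χ-* : ∀ a b → χ (a * b) ≡ χ a ℤ.* χ b
  χ-* a b with residuosity b
  ... | divisible  p∣b χb≡0 rewrite χb≡0 | χ-∣ (∣n⇒∣m*n a p∣b) = sym (ℤP.*-zeroʳ (χ a))
  ... | residue    p∤b χb≡1 y _ y²≋b rewrite χb≡1 =
    trans (cong χ (ℕP.*-comm a b)) (trans (χ-*-residueˡ y p∤b y²≋b a) (sym (ℤP.*-identityʳ (χ a))))
  ... | nonresidue p∤b χb≡-1 _ rewrite χb≡-1 =
    trans (cong χ (ℕP.*-comm a b)) (trans (χ-*-nonresidueˡ p∤b χb≡-1 a) (sym (trans (ℤP.*-comm (χ a) -1ℤ) (ℤP.-1*i≡-i (χ a)))))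

  inverse : ∀ {u} → ¬ p ∣ u → ∃ λ v → v < p × u * v ≋ 1
  inverse {u} p∤u = injectiveOn⇒surjectiveOn p (λ v → (u * v) % p) (λ v _ → m%n<n (u * v) p)
    (λ i j i<p j<p ui≋uj → ≋∧<⇒≡ i<p j<p (*-cancelˡ-≋ (∤⇒coprime p∤u) ui≋uj)) 1 (s≤s z<s)

  -- junk value 0 at multiples of p
  _⁻¹ : ℕ → ℕ
  a ⁻¹ with p ∣? a
  ... | yes _   = 0
  ... | no  p∤a = proj₁ (inverse p∤a)

  *-⁻¹ : ∀ {a} → ¬ p ∣ a → a * a ⁻¹ ≋ 1
  *-⁻¹ {a} p∤a with p ∣? a
  ... | yes p∣a  = ⊥-elim (p∤a p∣a)
  ... | no  p∤a′ = proj₂ (proj₂ (inverse p∤a′))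

  ⁻¹-∤ : ∀ {a} → ¬ p ∣ a → ¬ p ∣ a ⁻¹
  ⁻¹-∤ {a} p∤a p∣a⁻¹ = ∤-nonzero-residue z<s (s≤s z<s) (m%n≡0⇒n∣m 1 p (trans (sym (*-⁻¹ p∤a)) (n∣m⇒m%n≡0 _ p (∣n⇒∣m*n a p∣a⁻¹))))

  ⁻¹-injective : ∀ {i j} → ¬ p ∣ i → ¬ p ∣ j → i ⁻¹ ≋ j ⁻¹ → i ≋ j
  ⁻¹-injective {i} {j} p∤i p∤j i⁻¹≋j⁻¹ = begin
    i % p                    ≡⟨ cong (_% p) (ℕP.*-identityʳ i) ⟨
    (i * 1) % p              ≡⟨ ≋-* {i} {i} {1} {j * j ⁻¹} refl (sym (*-⁻¹ p∤j)) ⟩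
    (i * (j * j ⁻¹)) % p     ≡⟨ cong (_% p) (x∙yz≈y∙xz i j (j ⁻¹)) ⟩
    (j * (i * j ⁻¹)) % p     ≡⟨ ≋-* {j} {j} {i * j ⁻¹} {i * i ⁻¹} refl (≋-* {i} {i} {j ⁻¹} {i ⁻¹} refl (sym i⁻¹≋j⁻¹)) ⟩
    (j * (i * i ⁻¹)) % p     ≡⟨ ≋-* {j} {j} {i * i ⁻¹} {1} refl (*-⁻¹ p∤i) ⟩
    (j * 1) % p              ≡⟨ cong (_% p) (ℕP.*-identityʳ j) ⟩
    j % p                    ∎
    where open ≡-Reasoning

  -- for a ≢ 0, χ a χ (a c + D) = χ (c + D a⁻¹), and a ↦ c + D a⁻¹ is a bijection onto the residues ≢ c
  sumℤ-χ-χ-affine : ∀ c {D} → ¬ p ∣ D → sumℤ p (λ a → χ a ℤ.* χ (a * c + D)) ≡ ℤ.- χ c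
  sumℤ-χ-χ-affine c {D} p∤D = inverseˡ-unique (sumℤ p L) (χ c) (begin
    sumℤ p L ℤ.+ χ c        ≡⟨ cong (ℤ._+_ (sumℤ p L)) (χ-% c) ⟨
    sumℤ p L ℤ.+ χ (σ 0)    ≡⟨ sumℤ-agree-except p L (χ ∘ σ) 0 z<s L≡χ∘σ ⟩
    sumℤ p (χ ∘ σ) ℤ.+ L 0  ≡⟨ cong (ℤ._+ L 0) (sumℤ-reindex p σ σ-into σ-injective χ) ⟩
    sumℤ p χ ℤ.+ L 0        ≡⟨ cong₂ ℤ._+_ sumℤ-χ (ℤP.*-zeroˡ (χ D)) ⟩
    0ℤ                      ∎)
    where
    open ≡-Reasoning
    L : ℕ → ℤ
    L a = χ a ℤ.* χ (a * c + D)
    σ : ℕ → ℕ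
    σ zero        = c % p
    σ a@(suc _)   = (c + D * a ⁻¹) % p
    σ-into : MapsInto p σ
    σ-into zero    _ = m%n<n c p
    σ-into (suc a) _ = m%n<n (c + D * suc a ⁻¹) p
    c≉c+D* : ∀ {v} → ¬ p ∣ v → ¬ c + 0 ≋ c + D * v
    c≉c+D* p∤v c≋c+Dv = ∤-* p∤D p∤v (m%n≡0⇒n∣m _ p (sym (+-cancelˡ-≋ c c≋c+Dv)))
    σ-injective : InjectiveOn p σ
    σ-injective zero    zero    _   _   _ = refl
    σ-injective zero    (suc j) _   j<p e = ⊥-elim (c≉c+D* (⁻¹-∤ (∤-nonzero-residue z<s j<p)) (trans (cong (_% p) (ℕP.+-identityʳ c)) e))
    σ-injective (suc i) zero    i<p _   e = ⊥-elim (c≉c+D* (⁻¹-∤ (∤-nonzero-residue z<s i<p)) (trans (cong (_% p) (ℕP.+-identityʳ c)) (sym e)))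
    σ-injective (suc i) (suc j) i<p j<p e = ≋∧<⇒≡ i<p j<p (⁻¹-injective (∤-nonzero-residue z<s i<p) (∤-nonzero-residue z<s j<p)
      (*-cancelˡ-≋ (∤⇒coprime p∤D) (+-cancelˡ-≋ c e)))
    L≡χ∘σ : ∀ a → a < p → a ≢ 0 → L a ≡ χ (σ a)
    L≡χ∘σ zero    _   0≢0 = ⊥-elim (0≢0 refl)
    L≡χ∘σ a@(suc _) a<p _ = begin
      χ a ℤ.* χ (a * c + D)                    ≡⟨ cong (ℤ._*_ (χ a)) (trans (χ-cong {a * c + D} {a * (c + D * a ⁻¹)} ac+D≋a[c+Da⁻¹]) (χ-* a (c + D * a ⁻¹))) ⟩
      χ a ℤ.* (χ a ℤ.* χ (c + D * a ⁻¹))       ≡⟨ ℤP.*-assoc (χ a) (χ a) _ ⟨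
      χ a ℤ.* χ a ℤ.* χ (c + D * a ⁻¹)         ≡⟨ cong (ℤ._* χ (c + D * a ⁻¹)) (χ²≡1 p∤a) ⟩
      1ℤ ℤ.* χ (c + D * a ⁻¹)                  ≡⟨ ℤP.*-identityˡ _ ⟩
      χ (c + D * a ⁻¹)                         ≡⟨ χ-% (c + D * a ⁻¹) ⟨
      χ (σ a)                                  ∎
      where
      p∤a : ¬ p ∣ a
      p∤a = ∤-nonzero-residue z<s a<p
      ac+D≋a[c+Da⁻¹] : a * c + D ≋ a * (c + D * a ⁻¹)
      ac+D≋a[c+Da⁻¹] = begin
        (a * c + D) % p                 ≡⟨ cong (λ x → (a * c + x) % p) (ℕP.*-identityʳ D) ⟨
        (a * c + D * 1) % p             ≡⟨ ≋-+ {a * c} {a * c} {D * 1} {D * (a * a ⁻¹)} refl (≋-* {D} {D} {1} {a * a ⁻¹} refl (sym (*-⁻¹ p∤a))) ⟩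
        (a * c + D * (a * a ⁻¹)) % p    ≡⟨ cong (_% p) (factor a c D (a ⁻¹)) ⟩
        (a * (c + D * a ⁻¹)) % p        ∎
        where
        factor : ∀ a c D v → a * c + D * (a * v) ≡ a * (c + D * v)
        factor = ℕ-Solver.solve-∀

module KroneckerSymbol where

  open import Data.Nat as ℕ using (zero; z≤n; s≤s; z<s; _+_; _*_; _∸_; _^_; _%_; _/_; _≤_; _<_; _≡ᵇ_)
  import Data.Nat.Properties as ℕP
  open import Data.Nat.DivMod using (m*[n/m]≡n; m*n/n≡m; m/n<m; m≥n⇒m/n>0)
  open import Data.Nat.Divisibility using (_∣_; divides; 0∣⇒≡0; m%n≡0⇒n∣m; n∣m*n; n∣m⇒m%n≡0; ∣-refl; ∣-trans; ∣⇒≤)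
  open import Data.Nat.Primality
    using (Irreducible; euclidsLemma; irreducible⇒prime; prime⇒irreducible; prime⇒nonZero; prime⇒nonTrivial)
  open import Data.Nat.Induction using (<-rec)
  open import Data.Integer as ℤ using (ℤ; +_)
  import Data.Integer.Properties as ℤP
  open import Algebra.Properties.CommutativeSemigroup ℕP.*-commutativeSemigroup using () renaming (x∙yz≈y∙xz to ℕ-exchange)
  open import Algebra.Properties.CommutativeSemigroup ℤP.*-commutativeSemigroup using () renaming (x∙yz≈y∙xz to ℤ-exchange)
  open import Data.Bool using (true; false; T)
  open import Data.Product using (_×_; _,_; proj₁; proj₂)
  open import Data.Sum using (_⊎_; inj₁; inj₂)
  open import Data.Empty using (⊥-elim)
  open import Function using (_∘_)
  open import Relation.Binary.PropositionalEquality
  open import Relation.Nullary using (Dec; yes; no)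
  open import Relation.Binary.Definitions using (tri<; tri≈; tri>)
  open ResidueSymbols
  open IntegerResidue

  IsLeastDivisorFrom : ℕ → ℕ → ℕ → Set
  IsLeastDivisorFrom lo m d = d ∣ m × (∀ e → lo ≤ e → e < d → ¬ e ∣ m)

  minFactorFrom-least : ∀ f k m → 2 + k ≤ m → m ≤ f + suc k →
    IsLeastDivisorFrom (2 + k) m (2 + minFactorFrom f k m)
  minFactorFrom-least zero    k m 2+k≤m m≤1+k = ⊥-elim (ℕP.<⇒≱ 2+k≤m m≤1+k)
  minFactorFrom-least (suc f) k m 2+k≤m m≤f+2+k with (m % (2 + k)) ≡ᵇ 0 in divides?
  ... | true  = m%n≡0⇒n∣m m (2 + k) (ℕP.≡ᵇ⇒≡ _ 0 (subst T (sym divides?) _))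
              , λ e lo<e e<lo → ⊥-elim (ℕP.<⇒≱ e<lo lo<e)
  ... | false =
    let d∣m , none-below = minFactorFrom-least f (suc k) m 3+k≤m (subst (m ≤_) (sym (ℕP.+-suc f (suc k))) m≤f+2+k) in
    d∣m , none-from-2+k none-below
    where
    2+k∤m : ¬ 2 + k ∣ m
    2+k∤m 2+k∣m = subst T divides? (ℕP.≡⇒≡ᵇ _ 0 (n∣m⇒m%n≡0 m (2 + k) 2+k∣m))
    3+k≤m : 3 + k ≤ m
    3+k≤m = ℕP.≤∧≢⇒< 2+k≤m (λ 2+k≡m → 2+k∤m (subst (2 + k ∣_) 2+k≡m ∣-refl))
    none-from-2+k : ∀ {d} → (∀ e → 3 + k ≤ e → e < d → ¬ e ∣ m) → ∀ e → 2 + k ≤ e → e < d → ¬ e ∣ m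
    none-from-2+k none-below e 2+k≤e e<d with e ℕP.≟ 2 + k
    ... | yes refl = 2+k∤m
    ... | no  e≢2+k = none-below e (ℕP.≤∧≢⇒< 2+k≤e (e≢2+k ∘ sym)) e<d

  lpf : ℕ → ℕ
  lpf m = 2 + spf m

  lpf-least : ∀ {m} → 2 ≤ m → IsLeastDivisorFrom 2 m (lpf m)
  lpf-least {m} 2≤m = minFactorFrom-least m 0 m 2≤m (ℕP.m≤m+n m 1)

  lpf-∣ : ∀ {m} → 2 ≤ m → lpf m ∣ m
  lpf-∣ 2≤m = proj₁ (lpf-least 2≤m)

  lpf-prime : ∀ {m} → 2 ≤ m → Prime (lpf m)
  lpf-prime {m} 2≤m = irreducible⇒prime irreducible
    where
    irreducible : Irreducible (lpf m)
    irreducible {zero}          0∣q with () ← 0∣⇒≡0 0∣q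
    irreducible {suc zero}      _   = inj₁ refl
    irreducible {suc (suc d)}   d∣q with ℕP.m≤n⇒m<n∨m≡n (∣⇒≤ d∣q)
    ... | inj₁ d<q = ⊥-elim (proj₂ (lpf-least 2≤m) (2 + d) (s≤s (s≤s z≤n)) d<q (∣-trans d∣q (lpf-∣ 2≤m)))
    ... | inj₂ d≡q = inj₂ d≡q

  lpf-unique : ∀ {m s} → 2 ≤ m → 2 ≤ s → s ∣ m → (∀ e → 2 ≤ e → e < s → ¬ e ∣ m) → lpf m ≡ s
  lpf-unique {m} {s} 2≤m 2≤s s∣m s-least with ℕP.<-cmp (lpf m) s
  ... | tri< lpf<s _ _ = ⊥-elim (s-least (lpf m) (s≤s (s≤s z≤n)) lpf<s (lpf-∣ 2≤m))
  ... | tri≈ _ lpf≡s _ = lpf≡s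
  ... | tri> _ _ s<lpf = ⊥-elim (proj₂ (lpf-least 2≤m) s 2≤s s<lpf s∣m)

  lpf-cofactor : ∀ {m} → 2 ≤ m → m ≡ lpf m * (m / lpf m)
  lpf-cofactor 2≤m = sym (m*[n/m]≡n (lpf-∣ 2≤m))

  cofactor-positive : ∀ {m} → 2 ≤ m → 1 ≤ m / lpf m
  cofactor-positive 2≤m = m≥n⇒m/n>0 (∣⇒≤ {{ℕ.>-nonZero (ℕP.<-trans z<s 2≤m)}} (lpf-∣ 2≤m))

  cofactor-< : ∀ {m} → 2 ≤ m → m / lpf m < m
  cofactor-< {m@(suc _)} 2≤m = m/n<m m (lpf m) (s≤s (s≤s z≤n))

  kronAux-fuel : ∀ f g a m → 1 ≤ m → m ≤ f → m ≤ g → kronAux f a m ≡ kronAux g a m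
  kronAux-fuel (suc f) (suc g) a 1                _ _ _ = refl
  kronAux-fuel (suc f) (suc g) a m@(suc (suc m₀)) _ (s≤s m≤f) (s≤s m≤g) =
    cong (primeSym a (spf m) ℤ.*_) (kronAux-fuel f g a (m / lpf m) (cofactor-positive 2≤m)
      (ℕP.≤-trans m/q≤1+m₀ m≤f) (ℕP.≤-trans m/q≤1+m₀ m≤g))
    where
    2≤m : 2 ≤ m
    2≤m = s≤s (s≤s z≤n)
    m/q≤1+m₀ : m / lpf m ≤ suc m₀
    m/q≤1+m₀ = ℕP.≤-pred (cofactor-< 2≤m)

  primeSymbol : ℤ → ℕ → ℤ
  primeSymbol a q = primeSym a (q ∸ 2)

  kronecker-unfold : ∀ a {m} → 2 ≤ m → kronecker a m ≡ primeSymbol a (lpf m) ℤ.* kronecker a (m / lpf m)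
  kronecker-unfold a {suc zero} (s≤s ())
  kronecker-unfold a {m@(suc (suc m′))} 2≤m = cong (primeSym a (spf m) ℤ.*_)
    (kronAux-fuel (suc m′) (m / lpf m) a (m / lpf m) (cofactor-positive 2≤m) (ℕP.≤-pred (cofactor-< 2≤m)) ℕP.≤-refl)

  kronecker-via-lpf : ∀ a {m s} m′ → 2 ≤ m → lpf m ≡ s → m ≡ s * m′ → kronecker a m ≡ primeSymbol a s ℤ.* kronecker a m′
  kronecker-via-lpf a {m} m′ 2≤m refl m≡sm′ =
    trans (kronecker-unfold a 2≤m) (cong (λ n → primeSymbol a (lpf m) ℤ.* kronecker a n) m/s≡m′)
    where
    m/s≡m′ : m / lpf m ≡ m′
    m/s≡m′ = trans (cong (_/ lpf m) (trans m≡sm′ (ℕP.*-comm (lpf m) m′))) (m*n/n≡m m′ (lpf m))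

  prime⇒2≤ : ∀ {q} → Prime q → 2 ≤ q
  prime⇒2≤ {q} q-prime = ℕ.nonTrivial⇒n>1 q {{prime⇒nonTrivial q-prime}}

  kronecker-prime-* : ∀ a {q} → Prime q → ∀ m → 1 ≤ m → kronecker a (q * m) ≡ primeSymbol a q ℤ.* kronecker a m
  kronecker-prime-* a {q} q-prime = <-rec _ step
    where
    step : ∀ m → (∀ {m′} → m′ < m → 1 ≤ m′ → kronecker a (q * m′) ≡ primeSymbol a q ℤ.* kronecker a m′) →
      1 ≤ m → kronecker a (q * m) ≡ primeSymbol a q ℤ.* kronecker a m
    step m rec 1≤m = by-lpf (s ℕP.≟ q)
      where
      open ≡-Reasoning
      2≤qm : 2 ≤ q * m
      2≤qm = ℕP.≤-trans (prime⇒2≤ q-prime) (ℕP.m≤m*n q m {{ℕ.>-nonZero 1≤m}})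
      s : ℕ
      s = lpf (q * m)
      s-prime : Prime s
      s-prime = lpf-prime 2≤qm
      by-lpf : Dec (s ≡ q) → kronecker a (q * m) ≡ primeSymbol a q ℤ.* kronecker a m
      by-lpf (yes s≡q) = kronecker-via-lpf a m 2≤qm s≡q refl
      by-lpf (no  s≢q) = by-factor (euclidsLemma q m s-prime (lpf-∣ 2≤qm))
        where
        by-factor : s ∣ q ⊎ s ∣ m → kronecker a (q * m) ≡ primeSymbol a q ℤ.* kronecker a m
        by-factor (inj₁ s∣q) with prime⇒irreducible q-prime s∣q
        ... | inj₁ s≡1 = ⊥-elim (ℕP.<⇒≢ (prime⇒2≤ s-prime) (sym s≡1))
        ... | inj₂ s≡q = ⊥-elim (s≢q s≡q)
        by-factor (inj₂ (divides m′ m≡m′s)) = begin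
          kronecker a (q * m)                               ≡⟨ kronecker-via-lpf a (q * m′) 2≤qm refl qm≡s[qm′] ⟩
          primeSymbol a s ℤ.* kronecker a (q * m′)          ≡⟨ cong (primeSymbol a s ℤ.*_) (rec m′<m 1≤m′) ⟩
          primeSymbol a s ℤ.* (primeSymbol a q ℤ.* kronecker a m′) ≡⟨ ℤ-exchange (primeSymbol a s) (primeSymbol a q) _ ⟩
          primeSymbol a q ℤ.* (primeSymbol a s ℤ.* kronecker a m′) ≡⟨ cong (primeSymbol a q ℤ.*_) (kronecker-via-lpf a m′ 2≤m lpf[m]≡s m≡sm′) ⟨
          primeSymbol a q ℤ.* kronecker a m                 ∎
          where
          m≡sm′ : m ≡ s * m′
          m≡sm′ = trans m≡m′s (ℕP.*-comm m′ s)
          qm≡s[qm′] : q * m ≡ s * (q * m′)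
          qm≡s[qm′] = trans (cong (q *_) m≡sm′) (ℕ-exchange q s m′)
          1≤m′ : 1 ≤ m′
          1≤m′ = ℕP.n≢0⇒n>0 (λ { refl → ℕP.<⇒≢ 1≤m (sym m≡m′s) })
          m′<m : m′ < m
          m′<m = subst (m′ <_) (sym m≡m′s) (ℕP.m<m*n m′ s {{ℕ.>-nonZero 1≤m′}} (prime⇒2≤ s-prime))
          2≤m : 2 ≤ m
          2≤m = ℕP.≤-trans (prime⇒2≤ s-prime) (∣⇒≤ {{ℕ.>-nonZero 1≤m}} (divides m′ m≡m′s))
          lpf[m]≡s : lpf m ≡ s
          lpf[m]≡s = lpf-unique 2≤m (prime⇒2≤ s-prime) (divides m′ m≡m′s)
            (λ e 2≤e e<s e∣m → proj₂ (lpf-least 2≤qm) e 2≤e e<s (∣-trans e∣m (n∣m*n q)))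

  kronecker-* : ∀ a {m n} → 1 ≤ m → 1 ≤ n → kronecker a (m * n) ≡ kronecker a m ℤ.* kronecker a n
  kronecker-* a {m} {n} 1≤m 1≤n = <-rec _ step m 1≤m
    where
    step : ∀ m → (∀ {m′} → m′ < m → 1 ≤ m′ → kronecker a (m′ * n) ≡ kronecker a m′ ℤ.* kronecker a n) →
      1 ≤ m → kronecker a (m * n) ≡ kronecker a m ℤ.* kronecker a n
    step (suc zero)        _   _ = trans (cong (kronecker a) (ℕP.*-identityˡ n)) (sym (ℤP.*-identityˡ _))
    step m@(suc (suc _)) rec _ = begin
      kronecker a (m * n)                                       ≡⟨ cong (λ x → kronecker a (x * n)) (lpf-cofactor 2≤m) ⟩
      kronecker a (q * m′ * n)                                  ≡⟨ cong (kronecker a) (ℕP.*-assoc q m′ n) ⟩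
      kronecker a (q * (m′ * n))                                ≡⟨ kronecker-prime-* a (lpf-prime 2≤m) (m′ * n) (ℕP.*-mono-≤ 1≤m′ 1≤n) ⟩
      primeSymbol a q ℤ.* kronecker a (m′ * n)                  ≡⟨ cong (primeSymbol a q ℤ.*_) (rec (cofactor-< 2≤m) 1≤m′) ⟩
      primeSymbol a q ℤ.* (kronecker a m′ ℤ.* kronecker a n)    ≡⟨ ℤP.*-assoc (primeSymbol a q) _ _ ⟨
      primeSymbol a q ℤ.* kronecker a m′ ℤ.* kronecker a n      ≡⟨ cong (ℤ._* kronecker a n) (kronecker-unfold a 2≤m) ⟨
      kronecker a m ℤ.* kronecker a n                           ∎
      where
      open ≡-Reasoning
      2≤m : 2 ≤ m
      2≤m = s≤s (s≤s z≤n)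
      q m′ : ℕ
      q  = lpf m
      m′ = m / q
      1≤m′ : 1 ≤ m′
      1≤m′ = cofactor-positive 2≤m

  kronecker-^ : ∀ a {q} → Prime q → ∀ α → kronecker a (q ^ α) ≡ primeSymbol a q ℤ.^ α
  kronecker-^ a q-prime zero    = refl
  kronecker-^ a {q} q-prime (suc α) = trans (kronecker-prime-* a q-prime (q ^ α) (ℕP.m^n>0 q {{prime⇒nonZero q-prime}} α))
    (cong (primeSymbol a q ℤ.*_) (kronecker-^ a q-prime α))

  kronecker-cong : ∀ {a b} m → 1 ≤ m → (∀ q → Prime q → q ∣ m → primeSymbol a q ≡ primeSymbol b q) →
    kronecker a m ≡ kronecker b m
  kronecker-cong {a} {b} = <-rec _ step
    where
    step : ∀ m → (∀ {m′} → m′ < m → 1 ≤ m′ → (∀ q → Prime q → q ∣ m′ → primeSymbol a q ≡ primeSymbol b q) →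
                                      kronecker a m′ ≡ kronecker b m′) →
      1 ≤ m → (∀ q → Prime q → q ∣ m → primeSymbol a q ≡ primeSymbol b q) → kronecker a m ≡ kronecker b m
    step (suc zero)        _   _ _  = refl
    step m@(suc (suc _)) rec _ a≗b = begin
      kronecker a m                                       ≡⟨ kronecker-unfold a 2≤m ⟩
      primeSymbol a (lpf m) ℤ.* kronecker a (m / lpf m)   ≡⟨ cong₂ ℤ._*_ (a≗b (lpf m) (lpf-prime 2≤m) (lpf-∣ 2≤m))
                                                              (rec (cofactor-< 2≤m) (cofactor-positive 2≤m) (λ q q-prime q∣m′ → a≗b q q-prime (∣-trans q∣m′ m′∣m))) ⟩
      primeSymbol b (lpf m) ℤ.* kronecker b (m / lpf m)   ≡⟨ kronecker-unfold b 2≤m ⟨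
      kronecker b m                                       ∎
      where
      open ≡-Reasoning
      2≤m : 2 ≤ m
      2≤m = s≤s (s≤s z≤n)
      m′∣m : m / lpf m ∣ m
      m′∣m = divides (lpf m) (lpf-cofactor 2≤m)

  Admissible : ℕ → Set
  Admissible m = 0 < m × (2 ∣ m → 8 ∣ m)

  kronecker-periodic : ∀ {m} → Admissible m → ∀ i t → kronecker (i ℤ.+ + (t * m)) m ≡ kronecker i m
  kronecker-periodic {m} (0<m , 2∣m⇒8∣m) i t = kronecker-cong m 0<m period
    where
    period : ∀ q → Prime q → q ∣ m → primeSymbol (i ℤ.+ + (t * m)) q ≡ primeSymbol i q
    period (suc (suc zero))    _ 2∣m = kron2-cong (i ℤ.+ + (t * m)) i (%ℕ-+-*-∣ i t (2∣m⇒8∣m 2∣m))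
    period (suc (suc (suc q))) _ q∣m = legendre-cong (i ℤ.+ + (t * m)) i (suc q) (%ℕ-+-*-∣ i t q∣m)

module TwoAdic where

  open import Data.Nat as ℕ using (zero; z<s; s≤s; _≤_; _*_; _^_; _%_; _/_; _≡ᵇ_; _<_)
  import Data.Nat.Properties as ℕP
  open import Data.Nat.DivMod using (m%n<n; m*[n/m]≡n; m*n%n≡0; m*n/n≡m; m≡m%n+[m/n]*n)
  open import Data.Nat.Divisibility using (_∣_; _∣?_; divides; m%n≡0⇒n∣m; ∣n⇒∣m*n)
  open import Data.Nat.Primality using (euclidsLemma; prime[2]; prime⇒irreducible; ¬prime[1])
  open import Data.Bool using (true; false; T)
  open import Data.Product using (∃; _,_)
  open import Data.Sum using (inj₁; inj₂)
  open import Data.Empty using (⊥-elim)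
  open import Function using (_∘′_; _⇔_; mk⇔)
  open import Relation.Binary.PropositionalEquality
  open import Relation.Nullary using (yes; no)

  v2Aux-odd : ∀ f m → ¬ 2 ∣ m → v2Aux (suc f) m ≡ 0
  v2Aux-odd f zero  2∤0 = refl
  v2Aux-odd f (suc m) 2∤m with (suc m % 2) ≡ᵇ 0 in even?
  ... | true  = ⊥-elim (2∤m (m%n≡0⇒n∣m (suc m) 2 (ℕP.≡ᵇ⇒≡ _ 0 (subst T (sym even?) _))))
  ... | false = refl

  v2Aux-*2 : ∀ f m → 0 < m → v2Aux (suc f) (m * 2) ≡ suc (v2Aux f m)
  v2Aux-*2 f m@(suc _) _ with (m * 2 % 2) ≡ᵇ 0 in even?
  ... | true  = cong (suc ∘′ v2Aux f) (m*n/n≡m m 2)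
  ... | false = ⊥-elim (subst T even? (ℕP.≡⇒≡ᵇ _ 0 (m*n%n≡0 m 2)))

  υ₂-odd*2 : ∀ {m} → ¬ 2 ∣ m → υ₂ (m * 2) ≡ 1
  υ₂-odd*2 {zero}  2∤0 = ⊥-elim (2∤0 (divides 0 refl))
  υ₂-odd*2 {suc m} 2∤m = trans (v2Aux-*2 (suc (m * 2)) (suc m) z<s) (cong suc (v2Aux-odd (m * 2) (suc m) 2∤m))

  υ₂-odd*4 : ∀ {m} → ¬ 2 ∣ m → υ₂ (m * 2 * 2) ≡ 2
  υ₂-odd*4 {zero}  2∤0 = ⊥-elim (2∤0 (divides 0 refl))
  υ₂-odd*4 {suc m} 2∤m = trans (v2Aux-*2 (suc (suc (suc (m * 2 * 2)))) (suc m * 2) z<s)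
    (cong suc (trans (v2Aux-*2 (suc (suc (m * 2 * 2))) (suc m) z<s) (cong suc (v2Aux-odd (suc (m * 2 * 2)) (suc m) 2∤m))))

  υ₂≢1,2⇒2∣⇒8∣ : ∀ {m} → υ₂ m ≢ 1 → υ₂ m ≢ 2 → 2 ∣ m → 8 ∣ m
  υ₂≢1,2⇒2∣⇒8∣ υ₂≢1 υ₂≢2 (divides m₁ refl) with 2 ∣? m₁
  ... | no 2∤m₁ = ⊥-elim (υ₂≢1 (υ₂-odd*2 2∤m₁))
  ... | yes (divides m₂ refl) with 2 ∣? m₂
  ...   | no 2∤m₂ = ⊥-elim (υ₂≢2 (υ₂-odd*4 2∤m₂))
  ...   | yes (divides m₃ refl) = divides m₃ (trans (ℕP.*-assoc (m₃ * 2) 2 2) (ℕP.*-assoc m₃ 2 4))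

  oddAux-factor : ∀ f m → ∃ λ j → m ≡ 2 ^ j * oddAux f m
  oddAux-factor zero    m = 0 , sym (ℕP.*-identityˡ m)
  oddAux-factor (suc f) zero = 0 , refl
  oddAux-factor (suc f) m@(suc _) with (m % 2) ≡ᵇ 0 in even?
  ... | false = 0 , sym (ℕP.*-identityˡ m)
  ... | true  = let j , m/2≡2^j*o = oddAux-factor f (m / 2) in suc j , (begin
    m                                 ≡⟨ m*[n/m]≡n (m%n≡0⇒n∣m m 2 (ℕP.≡ᵇ⇒≡ _ 0 (subst T (sym even?) _))) ⟨
    2 * (m / 2)                       ≡⟨ cong (2 *_) m/2≡2^j*o ⟩
    2 * (2 ^ j * oddAux f (m / 2))    ≡⟨ ℕP.*-assoc 2 (2 ^ j) _ ⟨
    2 ^ suc j * oddAux f (m / 2)      ∎)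
    where open ≡-Reasoning

  oddPrime∣2^*⇒∣ : ∀ {p} → Prime p → p ≢ 2 → ∀ j x → p ∣ 2 ^ j * x → p ∣ x
  oddPrime∣2^*⇒∣ {p} p-prime p≢2 zero    x p∣x = subst (p ∣_) (ℕP.*-identityˡ x) p∣x
  oddPrime∣2^*⇒∣ {p} p-prime p≢2 (suc j) x p∣2^j+1x
    with euclidsLemma 2 (2 ^ j * x) p-prime (subst (p ∣_) (ℕP.*-assoc 2 (2 ^ j) x) p∣2^j+1x)
  ... | inj₂ p∣2^jx = oddPrime∣2^*⇒∣ p-prime p≢2 j x p∣2^jx
  ... | inj₁ p∣2 with prime⇒irreducible prime[2] p∣2
  ...   | inj₁ refl = ⊥-elim (¬prime[1] p-prime)
  ...   | inj₂ p≡2  = ⊥-elim (p≢2 p≡2)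

  oddPrime∣⇔∣oddPart : ∀ {p} → Prime p → p ≢ 2 → ∀ r → p ∣ r ⇔ p ∣ oddPart r
  oddPrime∣⇔∣oddPart {p} p-prime p≢2 r =
    let j , r≡2^j*o = oddAux-factor r r in mk⇔
      (λ p∣r → oddPrime∣2^*⇒∣ p-prime p≢2 j (oddPart r) (subst (p ∣_) r≡2^j*o p∣r))
      (λ p∣o → subst (p ∣_) (sym r≡2^j*o) (∣n⇒∣m*n (2 ^ j) p∣o))

  ¬2∣⇒odd : ∀ {n} → ¬ 2 ∣ n → ∃ λ u → n ≡ suc (u * 2)
  ¬2∣⇒odd {n} 2∤n with n % 2 | m%n<n n 2 | m≡m%n+[m/n]*n n 2
  ... | 0           | _              | n≡2q   = ⊥-elim (2∤n (divides (n / 2) n≡2q))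
  ... | 1           | _              | n≡1+2q = n / 2 , n≡1+2q
  ... | suc (suc _) | s≤s (s≤s ()) | _

  2∣∧1≤⇒even : ∀ {n} → 2 ∣ n → 1 ≤ n → ∃ λ j → n ≡ suc j * 2
  2∣∧1≤⇒even (divides zero    refl) ()
  2∣∧1≤⇒even (divides (suc j) refl) _  = j , refl

module ThetaMultiplicative where

  open import Data.Nat as ℕ using (_+_; _*_; _%_; _/_; _<_)
  import Data.Nat.Properties as ℕP
  open import Data.Nat.DivMod using (m≡m%n+[m/n]*n)
  open import Data.Nat.Coprimality as Coprimality using (Coprime)
  import Data.Nat.Tactic.RingSolver as ℕ-Solver
  open import Data.Integer as ℤ using (ℤ; +_)
  import Data.Integer.Properties as ℤP
  import Data.Integer.Tactic.RingSolver as ℤ-Solver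
  open import Algebra.Properties.CommutativeSemigroup ℤP.*-commutativeSemigroup using (interchange)
  open import Data.Product using (_,_)
  open import Relation.Binary.PropositionalEquality
  open FiniteSum
  open KroneckerSymbol

  ar²-4P : ℕ → ℕ → ℕ → ℤ
  ar²-4P r P a = + (a * (r * r)) ℤ.- + (4 * P)

  θ-term : ℕ → ℕ → ℕ → ℕ → ℤ
  θ-term r P m a = kronecker (+ a) m ℤ.* kronecker (ar²-4P r P a) m

  ar²-4P-+ : ∀ r P a t → ar²-4P r P (a + t) ≡ ar²-4P r P a ℤ.+ + (t * (r * r))
  ar²-4P-+ r P a t = begin
    + ((a + t) * (r * r)) ℤ.- + (4 * P)                     ≡⟨ cong (λ x → + x ℤ.- + (4 * P)) (ℕP.*-distribʳ-+ (r * r) a t) ⟩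
    + (a * (r * r) + t * (r * r)) ℤ.- + (4 * P)             ≡⟨ cong (ℤ._- + (4 * P)) (ℤP.pos-+ (a * (r * r)) (t * (r * r))) ⟩
    + (a * (r * r)) ℤ.+ + (t * (r * r)) ℤ.- + (4 * P)       ≡⟨ swap (+ (a * (r * r))) (+ (t * (r * r))) (+ (4 * P)) ⟩
    + (a * (r * r)) ℤ.- + (4 * P) ℤ.+ + (t * (r * r))       ∎
    where
    open ≡-Reasoning
    swap : ∀ x y z → x ℤ.+ y ℤ.- z ≡ x ℤ.- z ℤ.+ y
    swap = ℤ-Solver.solve-∀

  θ-term-periodic : ∀ r P {m} → Admissible m → ∀ a t → θ-term r P m (a + t * m) ≡ θ-term r P m a
  θ-term-periodic r P {m} adm a t = cong₂ ℤ._*_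
    (trans (cong (λ x → kronecker x m) (ℤP.pos-+ a (t * m))) (kronecker-periodic adm (+ a) t))
    (trans (cong (λ x → kronecker x m) (trans (ar²-4P-+ r P a (t * m)) (cong (λ x → ar²-4P r P a ℤ.+ + x) (rearrange t m (r * r)))))
           (kronecker-periodic adm (ar²-4P r P a) (t * (r * r))))
    where
    rearrange : ∀ t m s → t * m * s ≡ t * s * m
    rearrange = ℕ-Solver.solve-∀

  θ-term-% : ∀ r P {m} .{{_ : NonZero m}} → Admissible m → ∀ a → θ-term r P m a ≡ θ-term r P m (a % m)
  θ-term-% r P {m} adm a =
    trans (cong (θ-term r P m) (m≡m%n+[m/n]*n a m)) (θ-term-periodic r P adm (a % m) (a / m))

  θ-term-* : ∀ r P {m n} → 0 < m → 0 < n → ∀ a → θ-term r P (m * n) a ≡ θ-term r P m a ℤ.* θ-term r P n a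
  θ-term-* r P {m} {n} 0<m 0<n a =
    trans (cong₂ ℤ._*_ (kronecker-* (+ a) 0<m 0<n) (kronecker-* (ar²-4P r P a) 0<m 0<n))
      (interchange (kronecker (+ a) m) (kronecker (+ a) n) (kronecker (ar²-4P r P a) m) (kronecker (ar²-4P r P a) n))

  -- Chinese remainder theorem: a = j m + x runs over a period mod m n as x runs mod m and j mod n
  θ-* : ∀ r P {m n} → Admissible m → Admissible n → Coprime m n → θ r P (m * n) ≡ θ r P m ℤ.* θ r P n
  θ-* r P {m} {n} adm-m@(0<m , _) adm-n@(0<n , _) m⊥n = begin
    sumℤ (m * n) (θ-term r P (m * n))                                       ≡⟨ cong (λ k → sumℤ k (θ-term r P (m * n))) (ℕP.*-comm m n) ⟩
    sumℤ (n * m) (θ-term r P (m * n))                                       ≡⟨ sumℤ-* n m (θ-term r P (m * n)) ⟩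
    sumℤ n (λ j → sumℤ m (λ x → θ-term r P (m * n) (j * m + x)))            ≡⟨ sumℤ-cong n (λ j _ → sumℤ-cong m (λ x _ → split j x)) ⟩
    sumℤ n (λ j → sumℤ m (λ x → θ-term r P m x ℤ.* θ-term r P n (x + m * j))) ≡⟨ sumℤ-comm n m _ ⟩
    sumℤ m (λ x → sumℤ n (λ j → θ-term r P m x ℤ.* θ-term r P n (x + m * j))) ≡⟨ sumℤ-cong m (λ x _ → sumℤ-*ˡ n (θ-term r P m x) _) ⟩
    sumℤ m (λ x → θ-term r P m x ℤ.* sumℤ n (λ j → θ-term r P n (x + m * j))) ≡⟨ sumℤ-cong m (λ x _ → cong (θ-term r P m x ℤ.*_) (inner x)) ⟩
    sumℤ m (λ x → θ-term r P m x ℤ.* θ r P n)                              ≡⟨ sumℤ-cong m (λ x _ → ℤP.*-comm (θ-term r P m x) (θ r P n)) ⟩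
    sumℤ m (λ x → θ r P n ℤ.* θ-term r P m x)                              ≡⟨ sumℤ-*ˡ m (θ r P n) (θ-term r P m) ⟩
    θ r P n ℤ.* θ r P m                                                    ≡⟨ ℤP.*-comm (θ r P n) (θ r P m) ⟩
    θ r P m ℤ.* θ r P n                                                    ∎
    where
    open ≡-Reasoning
    instance
      n-nonZero : NonZero n
      n-nonZero = ℕ.>-nonZero 0<n
    split : ∀ j x → θ-term r P (m * n) (j * m + x) ≡ θ-term r P m x ℤ.* θ-term r P n (x + m * j)
    split j x = trans (θ-term-* r P 0<m 0<n (j * m + x)) (cong₂ ℤ._*_
      (trans (cong (θ-term r P m) (ℕP.+-comm (j * m) x)) (θ-term-periodic r P adm-m x j))
      (cong (θ-term r P n) (trans (ℕP.+-comm (j * m) x) (cong (_+_ x) (ℕP.*-comm j m)))))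
    inner : ∀ x → sumℤ n (λ j → θ-term r P n (x + m * j)) ≡ θ r P n
    inner x = trans (sumℤ-cong n (λ j _ → θ-term-% r P adm-n (x + m * j)))
                    (Congruence.sumℤ-reindex-affine n x (Coprimality.sym m⊥n) (θ-term r P n))

module IntegerPower where

  open import Data.Nat as ℕ using (zero; suc; _*_)
  open import Data.Integer as ℤ using (ℤ; _^_)
  import Data.Integer.Properties as ℤP
  open import Algebra.Properties.CommutativeSemigroup ℤP.*-commutativeSemigroup using (interchange)
  open import Relation.Binary.PropositionalEquality

  ^-distrib-* : ∀ x y n → (x ℤ.* y) ^ n ≡ x ^ n ℤ.* y ^ n
  ^-distrib-* x y zero    = refl
  ^-distrib-* x y (suc n) = trans (cong (x ℤ.* y ℤ.*_) (^-distrib-* x y n)) (interchange x y (x ^ n) (y ^ n))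

  ^-odd-idempotent : ∀ {v} → v ℤ.* (v ℤ.* v) ≡ v → ∀ j → v ^ suc (j * 2) ≡ v
  ^-odd-idempotent {v} v³≡v zero    = ℤP.*-identityʳ v
  ^-odd-idempotent {v} v³≡v (suc j) = trans (cong (λ w → v ℤ.* (v ℤ.* w)) (^-odd-idempotent v³≡v j)) v³≡v

  ^-even-idempotent : ∀ {v} → v ℤ.* (v ℤ.* v) ≡ v → ∀ j → v ^ (suc j * 2) ≡ v ℤ.* v
  ^-even-idempotent {v} v³≡v j = cong (v ℤ.*_) (^-odd-idempotent v³≡v j)

module ThetaOddPrimePower {k} (p-prime : Prime (suc (suc (suc k)))) (r P : ℕ) (p∤P : ¬ suc (suc (suc k)) ∣ P) where

  open import Data.Nat as ℕ using (zero; z≤n; s≤s; z<s; _+_; _*_; _∸_; _^_; _%_; _≤_; _<_)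
  import Data.Nat.Properties as ℕP
  open import Data.Nat.DivMod using (%-remove-+ˡ; [m+n]%n≡m%n; m<n⇒m%n≡m)
  open import Data.Nat.Divisibility using (m%n≡0⇒n∣m; ∣n⇒∣m*n; ∣⇒≤)
  import Data.Nat.Tactic.RingSolver as ℕ-Solver
  open import Data.Integer as ℤ using (ℤ; +_; 0ℤ; 1ℤ; -1ℤ)
  import Data.Integer.Properties as ℤP
  import Data.Integer.Tactic.RingSolver as ℤ-Solver
  open import Algebra.Properties.CommutativeSemigroup ℤP.*-commutativeSemigroup using (interchange)
  open import Data.Product using (_,_)
  open import Function using (_∘_)
  open import Relation.Binary.PropositionalEquality
  open FiniteSum
  open LegendreSymbol p-prime
  open Congruence p
  open IntegerResidue
  open KroneckerSymbol
  open ThetaMultiplicative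
  open IntegerPower
  open TwoAdic using (¬2∣⇒odd; 2∣∧1≤⇒even)

  -- D ≡ -4P (mod p), so Y a is a natural number representing a r² - 4P
  D : ℕ
  D = 4 * P * (p ∸ 1)

  Y : ℕ → ℕ
  Y a = a * (r * r) + D

  W : ℕ → ℤ
  W a = χ a ℤ.* χ (Y a)

  p∤2 : ¬ p ∣ 2
  p∤2 p∣2 = ℕP.<⇒≱ (s≤s (s≤s (s≤s z≤n))) (∣⇒≤ p∣2)

  p∤D : ¬ p ∣ D
  p∤D = ∤-* (subst (¬_ ∘ (p ∣_)) (four P) (∤-* p∤2 (∤-* p∤2 p∤P))) (∤-nonzero-residue z<s ℕP.≤-refl)
    where
    four : ∀ P → 2 * (2 * P) ≡ 4 * P
    four = ℕ-Solver.solve-∀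

  legendre-ar²-4P : ∀ a → legendre (ar²-4P r P a) (suc k) ≡ χ (Y a)
  legendre-ar²-4P a = begin
    legendre (ar²-4P r P a) (suc k)  ≡⟨ legendre≡χ-%ℕ (ar²-4P r P a) ⟩
    χ (ar²-4P r P a ℤ.%ℕ p)          ≡⟨ cong χ (%ℕ-via-ℕ (ar²-4P r P a) (4 * P) (Y a) p ar²-4P+4Pp≡Y) ⟩
    χ (Y a % p)                      ≡⟨ χ-% (Y a) ⟩
    χ (Y a)                          ∎
    where
    open ≡-Reasoning
    ar²-4P+4Pp≡Y : ar²-4P r P a ℤ.+ + (4 * P * p) ≡ + Y a
    ar²-4P+4Pp≡Y = begin
      + (a * (r * r)) ℤ.- + (4 * P) ℤ.+ + (4 * P * p)        ≡⟨ cong (λ x → + (a * (r * r)) ℤ.- + (4 * P) ℤ.+ + x) (ℕP.*-suc (4 * P) (p ∸ 1)) ⟩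
      + (a * (r * r)) ℤ.- + (4 * P) ℤ.+ + (4 * P + D)        ≡⟨ cong (ℤ._+_ (+ (a * (r * r)) ℤ.- + (4 * P))) (ℤP.pos-+ (4 * P) D) ⟩
      + (a * (r * r)) ℤ.- + (4 * P) ℤ.+ (+ (4 * P) ℤ.+ + D) ≡⟨ cancel (+ (a * (r * r))) (+ (4 * P)) (+ D) ⟩
      + (a * (r * r)) ℤ.+ + D                                ≡⟨ ℤP.pos-+ (a * (r * r)) D ⟨
      + Y a                                                  ∎
      where
      cancel : ∀ x y z → x ℤ.- y ℤ.+ (y ℤ.+ z) ≡ x ℤ.+ z
      cancel = ℤ-Solver.solve-∀

  θ-term-p^ : ∀ α a → θ-term r P (p ^ α) a ≡ W a ℤ.^ α
  θ-term-p^ α a = trans (cong₂ ℤ._*_ (kronecker-^ (+ a) p-prime α)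
                                      (trans (kronecker-^ (ar²-4P r P a) p-prime α) (cong (ℤ._^ α) (legendre-ar²-4P a))))
                        (sym (^-distrib-* (χ a) (χ (Y a)) α))

  W-periodic : ∀ a → W (p + a) ≡ W a
  W-periodic a = cong₂ ℤ._*_ (χ-cong {p + a} {a} p+a≋a) (χ-cong {Y (p + a)} {Y a} Y[p+a]≋Y)
    where
    p+a≋a : p + a ≋ a
    p+a≋a = trans (cong (_% p) (ℕP.+-comm p a)) ([m+n]%n≡m%n a p)
    Y[p+a]≋Y : Y (p + a) ≋ Y a
    Y[p+a]≋Y = trans (cong (_% p) (expand p a (r * r) D)) (+-*-≋ (Y a) (r * r))
      where
      expand : ∀ p a c D → (p + a) * c + D ≡ a * c + D + c * p
      expand = ℕ-Solver.solve-∀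

  θ-p^suc : ∀ β → θ r P (p ^ suc β) ≡ + (p ^ β) ℤ.* sumℤ p (λ a → W a ℤ.^ suc β)
  θ-p^suc β = begin
    sumℤ (p ^ suc β) (θ-term r P (p ^ suc β))        ≡⟨ sumℤ-cong (p ^ suc β) (λ a _ → θ-term-p^ (suc β) a) ⟩
    sumℤ (p * p ^ β) (λ a → W a ℤ.^ suc β)           ≡⟨ cong (λ n → sumℤ n (λ a → W a ℤ.^ suc β)) (ℕP.*-comm p (p ^ β)) ⟩
    sumℤ (p ^ β * p) (λ a → W a ℤ.^ suc β)           ≡⟨ sumℤ-periodic (p ^ β) p (λ a → W a ℤ.^ suc β) (cong (ℤ._^ suc β) ∘ W-periodic) ⟩
    + (p ^ β) ℤ.* sumℤ p (λ a → W a ℤ.^ suc β)       ∎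
    where open ≡-Reasoning

  W³≡W : ∀ a → W a ℤ.* (W a ℤ.* W a) ≡ W a
  W³≡W a = trans (regroup (χ a) (χ (Y a))) (cong₂ ℤ._*_ (χ³≡χ a) (χ³≡χ (Y a)))
    where
    regroup : ∀ x y → x ℤ.* y ℤ.* (x ℤ.* y ℤ.* (x ℤ.* y)) ≡ x ℤ.* (x ℤ.* x) ℤ.* (y ℤ.* (y ℤ.* y))
    regroup = ℤ-Solver.solve-∀

  sumℤ-W : sumℤ p W ≡ ℤ.- χ (r * r)
  sumℤ-W = sumℤ-χ-χ-affine (r * r) p∤D

  W²≡1-δ-δ : ∀ a → a < p → W a ℤ.* W a ≡ 1ℤ ℤ.- δ 0 (a % p) ℤ.- δ 0 (Y a % p)
  W²≡1-δ-δ a a<p = begin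
    χ a ℤ.* χ (Y a) ℤ.* (χ a ℤ.* χ (Y a))                  ≡⟨ interchange (χ a) (χ (Y a)) (χ a) (χ (Y a)) ⟩
    χ a ℤ.* χ a ℤ.* (χ (Y a) ℤ.* χ (Y a))                  ≡⟨ cong₂ ℤ._*_ (χ²≡1-δ a) (χ²≡1-δ (Y a)) ⟩
    (1ℤ ℤ.- δ 0 (a % p)) ℤ.* (1ℤ ℤ.- δ 0 (Y a % p))        ≡⟨ expand (δ 0 (a % p)) (δ 0 (Y a % p)) ⟩
    1ℤ ℤ.- δ 0 (a % p) ℤ.- δ 0 (Y a % p) ℤ.+ δ 0 (a % p) ℤ.* δ 0 (Y a % p)
                                                           ≡⟨ cong (ℤ._+_ (1ℤ ℤ.- δ 0 (a % p) ℤ.- δ 0 (Y a % p))) (no-common-root a a<p) ⟩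
    1ℤ ℤ.- δ 0 (a % p) ℤ.- δ 0 (Y a % p) ℤ.+ 0ℤ           ≡⟨ ℤP.+-identityʳ _ ⟩
    1ℤ ℤ.- δ 0 (a % p) ℤ.- δ 0 (Y a % p)                  ∎
    where
    open ≡-Reasoning
    expand : ∀ i j → (1ℤ ℤ.- i) ℤ.* (1ℤ ℤ.- j) ≡ 1ℤ ℤ.- i ℤ.- j ℤ.+ i ℤ.* j
    expand = ℤ-Solver.solve-∀
    no-common-root : ∀ a → a < p → δ 0 (a % p) ℤ.* δ 0 (Y a % p) ≡ 0ℤ
    no-common-root zero    _   = cong (1ℤ ℤ.*_) (δ-≢ (p∤D ∘ m%n≡0⇒n∣m D p))
    no-common-root (suc a) a<p rewrite m<n⇒m%n≡m a<p = refl

  sumℤ-W² : sumℤ p (λ a → W a ℤ.* W a) ≡ + (p ∸ 1) ℤ.- sumℤ p (λ a → δ 0 (Y a % p))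
  sumℤ-W² = begin
    sumℤ p (λ a → W a ℤ.* W a)                                                    ≡⟨ sumℤ-cong p W²≡1-δ-δ ⟩
    sumℤ p (λ a → 1ℤ ℤ.- δ 0 (a % p) ℤ.- δ 0 (Y a % p))                           ≡⟨ sumℤ-sub p _ _ ⟩
    sumℤ p (λ a → 1ℤ ℤ.- δ 0 (a % p)) ℤ.- sumℤ p (λ a → δ 0 (Y a % p))             ≡⟨ cong (ℤ._- sumℤ p (λ a → δ 0 (Y a % p))) Σ[1-δ]≡p-1 ⟩
    + (p ∸ 1) ℤ.- sumℤ p (λ a → δ 0 (Y a % p))                                     ∎
    where
    open ≡-Reasoning
    Σ[1-δ]≡p-1 : sumℤ p (λ a → 1ℤ ℤ.- δ 0 (a % p)) ≡ + (p ∸ 1)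
    Σ[1-δ]≡p-1 = begin
      sumℤ p (λ a → 1ℤ ℤ.- δ 0 (a % p))               ≡⟨ sumℤ-sub p (λ _ → 1ℤ) (λ a → δ 0 (a % p)) ⟩
      sumℤ p (λ _ → 1ℤ) ℤ.- sumℤ p (λ a → δ 0 (a % p)) ≡⟨ cong₂ ℤ._-_ (sumℤ-const p 1ℤ) (trans (sumℤ-cong p (λ a a<p → cong (δ 0) (m<n⇒m%n≡m a<p))) (sumℤ-δ p z<s)) ⟩
      + p ℤ.* 1ℤ ℤ.- 1ℤ                               ≡⟨ cong (ℤ._- 1ℤ) (ℤP.*-identityʳ (+ p)) ⟩
      + (p ∸ 1)                                       ∎

  sumℤ-δ-Y-∣ : p ∣ r → sumℤ p (λ a → δ 0 (Y a % p)) ≡ 0ℤ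
  sumℤ-δ-Y-∣ p∣r = trans (sumℤ-cong p (λ a _ → δ-≢ (p∤D ∘ m%n≡0⇒n∣m D p ∘ trans (sym (Y≋D a))))) (sumℤ-0 p)
    where
    Y≋D : ∀ a → Y a ≋ D
    Y≋D a = %-remove-+ˡ D (∣n⇒∣m*n a (∣n⇒∣m*n r p∣r))

  sumℤ-δ-Y-∤ : ¬ p ∣ r → sumℤ p (λ a → δ 0 (Y a % p)) ≡ 1ℤ
  sumℤ-δ-Y-∤ p∤r = begin
    sumℤ p (λ a → δ 0 (Y a % p))                  ≡⟨ sumℤ-cong p (λ a _ → cong (λ x → δ 0 (x % p)) (trans (ℕP.+-comm (a * (r * r)) D) (cong (_+_ D) (ℕP.*-comm a (r * r))))) ⟩
    sumℤ p (λ a → δ 0 ((D + r * r * a) % p))      ≡⟨ sumℤ-reindex-affine D (∤⇒coprime (∤-* p∤r p∤r)) (δ 0) ⟩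
    sumℤ p (δ 0)                                  ≡⟨ sumℤ-δ p z<s ⟩
    1ℤ                                            ∎
    where open ≡-Reasoning

  θ-p^odd : ∀ j → θ r P (p ^ suc (j * 2)) ≡ + (p ^ (j * 2)) ℤ.* ℤ.- χ (r * r)
  θ-p^odd j = begin
    θ r P (p ^ suc (j * 2))                                ≡⟨ θ-p^suc (j * 2) ⟩
    + (p ^ (j * 2)) ℤ.* sumℤ p (λ a → W a ℤ.^ suc (j * 2)) ≡⟨ cong (ℤ._*_ (+ (p ^ (j * 2)))) (sumℤ-cong p (λ a _ → ^-odd-idempotent (W³≡W a) j)) ⟩
    + (p ^ (j * 2)) ℤ.* sumℤ p W                           ≡⟨ cong (ℤ._*_ (+ (p ^ (j * 2)))) sumℤ-W ⟩
    + (p ^ (j * 2)) ℤ.* ℤ.- χ (r * r)                      ∎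
    where open ≡-Reasoning

  θ-p^even : ∀ j → θ r P (p ^ (suc j * 2)) ≡ + (p ^ suc (j * 2)) ℤ.* (+ (p ∸ 1) ℤ.- sumℤ p (λ a → δ 0 (Y a % p)))
  θ-p^even j = begin
    θ r P (p ^ (suc j * 2))                                      ≡⟨ θ-p^suc (suc (j * 2)) ⟩
    + (p ^ suc (j * 2)) ℤ.* sumℤ p (λ a → W a ℤ.^ (suc j * 2))   ≡⟨ cong (ℤ._*_ (+ (p ^ suc (j * 2)))) (sumℤ-cong p (λ a _ → ^-even-idempotent (W³≡W a) j)) ⟩
    + (p ^ suc (j * 2)) ℤ.* sumℤ p (λ a → W a ℤ.* W a)           ≡⟨ cong (ℤ._*_ (+ (p ^ suc (j * 2)))) sumℤ-W² ⟩
    + (p ^ suc (j * 2)) ℤ.* (+ (p ∸ 1) ℤ.- sumℤ p (λ a → δ 0 (Y a % p))) ∎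
    where open ≡-Reasoning

  θ-p^odd-∤ : ¬ p ∣ r → ∀ α → ¬ 2 ∣ α → θ r P (p ^ α) ≡ ℤ.- (+ (p ^ (α ∸ 1)))
  θ-p^odd-∤ p∤r α 2∤α with ¬2∣⇒odd 2∤α
  ... | j , refl = begin
    θ r P (p ^ suc (j * 2))               ≡⟨ θ-p^odd j ⟩
    + (p ^ (j * 2)) ℤ.* ℤ.- χ (r * r)     ≡⟨ cong (λ x → + (p ^ (j * 2)) ℤ.* ℤ.- x) (χ-square r (∤-* p∤r p∤r) refl) ⟩
    + (p ^ (j * 2)) ℤ.* -1ℤ               ≡⟨ ℤP.*-comm (+ (p ^ (j * 2))) -1ℤ ⟩
    -1ℤ ℤ.* + (p ^ (j * 2))               ≡⟨ ℤP.-1*i≡-i (+ (p ^ (j * 2))) ⟩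
    ℤ.- (+ (p ^ (j * 2)))                 ∎
    where open ≡-Reasoning

  θ-p^odd-∣ : p ∣ r → ∀ α → ¬ 2 ∣ α → θ r P (p ^ α) ≡ 0ℤ
  θ-p^odd-∣ p∣r α 2∤α with ¬2∣⇒odd 2∤α
  ... | j , refl = trans (θ-p^odd j) (trans (cong (λ x → + (p ^ (j * 2)) ℤ.* ℤ.- x) (χ-∣ (∣n⇒∣m*n r p∣r)))
                                            (ℤP.*-zeroʳ (+ (p ^ (j * 2)))))

  θ-p^even-∤ : ¬ p ∣ r → ∀ α → 1 ≤ α → 2 ∣ α → θ r P (p ^ α) ≡ + (p ^ (α ∸ 1) * (p ∸ 2))
  θ-p^even-∤ p∤r α 1≤α 2∣α with 2∣∧1≤⇒even 2∣α 1≤α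
  ... | j , refl = trans (θ-p^even j) (trans (cong (λ x → + (p ^ suc (j * 2)) ℤ.* (+ (p ∸ 1) ℤ.- x)) (sumℤ-δ-Y-∤ p∤r))
                                              (sym (ℤP.pos-* (p ^ suc (j * 2)) (p ∸ 2))))

  θ-p^even-∣ : p ∣ r → ∀ α → 1 ≤ α → 2 ∣ α → θ r P (p ^ α) ≡ + (p ^ (α ∸ 1) * (p ∸ 1))
  θ-p^even-∣ p∣r α 1≤α 2∣α with 2∣∧1≤⇒even 2∣α 1≤α
  ... | j , refl = trans (θ-p^even j) (trans (cong (λ x → + (p ^ suc (j * 2)) ℤ.* (+ (p ∸ 1) ℤ.- x)) (sumℤ-δ-Y-∣ p∣r))
                                              (trans (cong (ℤ._*_ (+ (p ^ suc (j * 2)))) (ℤP.+-identityʳ (+ (p ∸ 1))))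
                                                     (sym (ℤP.pos-* (p ^ suc (j * 2)) (p ∸ 1)))))

module ThetaPowerOfTwo where

  open import Data.Nat as ℕ using (zero; s≤s; _+_; _*_; _∸_; _^_; _%_; _/_; _≤_; _<_)
  import Data.Nat.Properties as ℕP
  open import Data.Nat.DivMod using ([m+kn]%n≡m%n; [m+n]%n≡m%n; m%n<n; m∣n⇒o%n%m≡o%m; m≡m%n+[m/n]*n)
  open import Data.Nat.Divisibility using (_∣_; divides; n∣m⇒m%n≡0; ∣m⇒∣m*n; ∣m∣n⇒∣m+n; ∣n⇒∣m*n)
  open import Data.Nat.Primality using (prime[2])
  import Data.Nat.Tactic.RingSolver as ℕ-Solver
  open import Data.Integer as ℤ using (ℤ; +_; 0ℤ; -1ℤ)
  import Data.Integer.Properties as ℤP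
  import Data.Integer.Tactic.RingSolver as ℤ-Solver
  open import Data.Product using (_,_)
  open import Relation.Binary.PropositionalEquality
  open import Relation.Nullary using (¬_)
  open FiniteSum
  open IntegerResidue
  open ResidueSymbols
  open KroneckerSymbol
  open ThetaMultiplicative
  open IntegerPower
  open TwoAdic using (¬2∣⇒odd)

  θ-term-2^ : ∀ r P α a → θ-term r P (2 ^ α) a ≡ (kron2 (+ a) ℤ.* kron2 (ar²-4P r P a)) ℤ.^ α
  θ-term-2^ r P α a = trans (cong₂ ℤ._*_ (kronecker-^ (+ a) prime[2] α) (kronecker-^ (ar²-4P r P a) prime[2] α))
                            (sym (^-distrib-* (kron2 (+ a)) (kron2 (ar²-4P r P a)) α))

  kron2-ar²-4P : ∀ r P a → kron2 (ar²-4P r P a) ≡ kron2 (+ (a * (r * r) + 4 * P * 7))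
  kron2-ar²-4P r P a = kron2-cong (ar²-4P r P a) (+ (a * (r * r) + 4 * P * 7)) (%ℕ-via-ℕ (ar²-4P r P a) (4 * P) _ 8 shift)
    where
    shift : ar²-4P r P a ℤ.+ + (4 * P * 8) ≡ + (a * (r * r) + 4 * P * 7)
    shift = begin
      + (a * (r * r)) ℤ.- + (4 * P) ℤ.+ + (4 * P * 8)              ≡⟨ cong (λ x → + (a * (r * r)) ℤ.- + (4 * P) ℤ.+ + x) (ℕP.*-suc (4 * P) 7) ⟩
      + (a * (r * r)) ℤ.- + (4 * P) ℤ.+ + (4 * P + 4 * P * 7)      ≡⟨ cong (ℤ._+_ (+ (a * (r * r)) ℤ.- + (4 * P))) (ℤP.pos-+ (4 * P) (4 * P * 7)) ⟩
      + (a * (r * r)) ℤ.- + (4 * P) ℤ.+ (+ (4 * P) ℤ.+ + (4 * P * 7)) ≡⟨ cancel (+ (a * (r * r))) (+ (4 * P)) (+ (4 * P * 7)) ⟩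
      + (a * (r * r)) ℤ.+ + (4 * P * 7)                           ≡⟨ ℤP.pos-+ (a * (r * r)) (4 * P * 7) ⟨
      + (a * (r * r) + 4 * P * 7)                                 ∎
      where
      open ≡-Reasoning
      cancel : ∀ x y z → x ℤ.- y ℤ.+ (y ℤ.+ z) ≡ x ℤ.+ z
      cancel = ℤ-Solver.solve-∀

  kron2-even : ∀ n → 2 ∣ n → kron2 (+ n) ≡ 0ℤ
  kron2-even n 2∣n = trans (kron2≡kron2OfResidue (+ n))
    (even-residue (n % 8) (m%n<n n 8) (trans (m∣n⇒o%n%m≡o%m 2 8 n (divides 4 refl)) (n∣m⇒m%n≡0 n 2 2∣n)))
    where
    even-residue : ∀ t → t < 8 → t % 2 ≡ 0 → kron2OfResidue t ≡ 0ℤ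
    even-residue 0 _ _ = refl
    even-residue 2 _ _ = refl
    even-residue 4 _ _ = refl
    even-residue 6 _ _ = refl
    even-residue 1 _ ()
    even-residue 3 _ ()
    even-residue 5 _ ()
    even-residue 7 _ ()
    even-residue (suc (suc (suc (suc (suc (suc (suc (suc _)))))))) (s≤s (s≤s (s≤s (s≤s (s≤s (s≤s (s≤s (s≤s ())))))))) _

  θ-2^-even : ∀ r P α → 2 ∣ r → 1 ≤ α → θ r P (2 ^ α) ≡ 0ℤ
  θ-2^-even r P (suc α) 2∣r _ = trans (sumℤ-cong (2 ^ suc α) term≡0) (sumℤ-0 (2 ^ suc α))
    where
    term≡0 : ∀ a → a < 2 ^ suc α → θ-term r P (2 ^ suc α) a ≡ 0ℤ
    term≡0 a _ = begin
      θ-term r P (2 ^ suc α) a                                ≡⟨ θ-term-2^ r P (suc α) a ⟩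
      (kron2 (+ a) ℤ.* kron2 (ar²-4P r P a)) ℤ.^ suc α        ≡⟨ cong (λ x → (kron2 (+ a) ℤ.* x) ℤ.^ suc α) (trans (kron2-ar²-4P r P a) (kron2-even _ 2∣ar²+28P)) ⟩
      (kron2 (+ a) ℤ.* 0ℤ) ℤ.^ suc α                          ≡⟨ cong (ℤ._^ suc α) (ℤP.*-zeroʳ (kron2 (+ a))) ⟩
      0ℤ ℤ.* 0ℤ ℤ.^ α                                         ≡⟨ ℤP.*-zeroˡ (0ℤ ℤ.^ α) ⟩
      0ℤ                                                      ∎
      where
      open ≡-Reasoning
      2∣ar²+28P : 2 ∣ a * (r * r) + 4 * P * 7
      2∣ar²+28P = ∣m∣n⇒∣m+n (∣n⇒∣m*n a (∣m⇒∣m*n r 2∣r)) (∣m⇒∣m*n 7 (∣m⇒∣m*n P (divides 2 refl)))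

  odd²%8≡1 : ∀ u → (suc (u * 2) * suc (u * 2)) % 8 ≡ 1
  odd²%8≡1 zero    = refl
  odd²%8≡1 (suc u) = trans (cong (_% 8) (expand u)) (trans ([m+kn]%n≡m%n (suc (u * 2) * suc (u * 2)) (suc u) 8) (odd²%8≡1 u))
    where
    expand : ∀ u → suc (suc u * 2) * suc (suc u * 2) ≡ suc (u * 2) * suc (u * 2) + suc u * 8
    expand = ℕ-Solver.solve-∀

  kron2-ar²-4P-odd : ∀ {r P} → ¬ 2 ∣ r → ¬ 2 ∣ P → ∀ a → kron2 (ar²-4P r P a) ≡ kron2 (+ (a + 4))
  kron2-ar²-4P-odd {r} {P} 2∤r 2∤P a with ¬2∣⇒odd 2∤r | ¬2∣⇒odd 2∤P
  ... | u , refl | w , refl = trans (kron2-ar²-4P r P a) (kron2-cong (+ (a * r² + 4 * P * 7)) (+ (a + 4)) (begin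
    (a * r² + 4 * P * 7) % 8                              ≡⟨ cong (λ x → (a * x + 4 * P * 7) % 8) r²≡1+8q ⟩
    (a * (1 + q * 8) + 4 * P * 7) % 8                     ≡⟨ cong (_% 8) (regroup a q w) ⟩
    (a + 4 + (a * q + 3 + w * 7) * 8) % 8                 ≡⟨ [m+kn]%n≡m%n (a + 4) (a * q + 3 + w * 7) 8 ⟩
    (a + 4) % 8                                           ∎))
    where
    open ≡-Reasoning
    r² q : ℕ
    r² = r * r
    q  = r² / 8
    r²≡1+8q : r² ≡ 1 + q * 8
    r²≡1+8q = trans (m≡m%n+[m/n]*n r² 8) (cong (_+ q * 8) (odd²%8≡1 u))
    regroup : ∀ a q w → a * (1 + q * 8) + 4 * suc (w * 2) * 7 ≡ a + 4 + (a * q + 3 + w * 7) * 8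
    regroup = ℕ-Solver.solve-∀

  V : ℕ → ℤ
  V a = kron2 (+ a) ℤ.* kron2 (+ (a + 4))

  V-periodic : ∀ a → V (8 + a) ≡ V a
  V-periodic a = cong₂ ℤ._*_ (kron2-cong (+ (8 + a)) (+ a) (trans (cong (_% 8) (ℕP.+-comm 8 a)) ([m+n]%n≡m%n a 8)))
                             (kron2-cong (+ (8 + a + 4)) (+ (a + 4)) (trans (cong (_% 8) (ℕP.+-comm 8 (a + 4))) ([m+n]%n≡m%n (a + 4) 8)))

  -- V vanishes at even a and is -1 at odd a
  sumℤ-V^ : ∀ α → sumℤ 8 (λ a → V a ℤ.^ suc α) ≡ + 4 ℤ.* -1ℤ ℤ.^ suc α
  sumℤ-V^ α = four-times (-1ℤ ℤ.^ suc α)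
    where
    four-times : ∀ x → 0ℤ ℤ.+ 0ℤ ℤ.+ x ℤ.+ 0ℤ ℤ.+ x ℤ.+ 0ℤ ℤ.+ x ℤ.+ 0ℤ ℤ.+ x ≡ + 4 ℤ.* x
    four-times = ℤ-Solver.solve-∀

  θ-2^-odd : ∀ {r P} α → ¬ 2 ∣ r → ¬ 2 ∣ P → 3 ≤ α → θ r P (2 ^ α) ≡ -1ℤ ℤ.^ α ℤ.* + (2 ^ (α ∸ 1))
  θ-2^-odd (suc zero)       _ _ (s≤s ())
  θ-2^-odd (suc (suc zero)) _ _ (s≤s (s≤s ()))
  θ-2^-odd {r} {P} α@(suc (suc (suc β))) 2∤r 2∤P _ = begin
    sumℤ (2 ^ α) (θ-term r P (2 ^ α))            ≡⟨ sumℤ-cong (2 ^ α) (λ a _ → trans (θ-term-2^ r P α a) (cong (λ x → (kron2 (+ a) ℤ.* x) ℤ.^ α) (kron2-ar²-4P-odd 2∤r 2∤P a))) ⟩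
    sumℤ (2 ^ α) (λ a → V a ℤ.^ α)               ≡⟨ cong (λ n → sumℤ n (λ a → V a ℤ.^ α)) (eight-times (2 ^ β)) ⟩
    sumℤ (2 ^ β * 8) (λ a → V a ℤ.^ α)           ≡⟨ sumℤ-periodic (2 ^ β) 8 (λ a → V a ℤ.^ α) (λ a → cong (ℤ._^ α) (V-periodic a)) ⟩
    + (2 ^ β) ℤ.* sumℤ 8 (λ a → V a ℤ.^ α)       ≡⟨ cong (ℤ._*_ (+ (2 ^ β))) (sumℤ-V^ (suc (suc β))) ⟩
    + (2 ^ β) ℤ.* (+ 4 ℤ.* -1ℤ ℤ.^ α)            ≡⟨ rearrange (+ (2 ^ β)) (-1ℤ ℤ.^ α) ⟩
    -1ℤ ℤ.^ α ℤ.* (+ 4 ℤ.* + (2 ^ β))            ≡⟨ cong (ℤ._*_ (-1ℤ ℤ.^ α)) (trans (sym (ℤP.pos-* 4 (2 ^ β))) (cong +_ (four-times (2 ^ β)))) ⟩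
    -1ℤ ℤ.^ α ℤ.* + (2 ^ (α ∸ 1))                ∎
    where
    open ≡-Reasoning
    eight-times : ∀ x → 2 * (2 * (2 * x)) ≡ x * 8
    eight-times = ℕ-Solver.solve-∀
    rearrange : ∀ a x → a ℤ.* (+ 4 ℤ.* x) ≡ x ℤ.* (+ 4 ℤ.* a)
    rearrange = ℤ-Solver.solve-∀
    four-times : ∀ x → 4 * x ≡ 2 * (2 * x)
    four-times = ℕ-Solver.solve-∀

module OddPrime where

  open import Data.Nat as ℕ using (zero; z≤n; s≤s; _*_; _^_; _∸_; _≤_)
  open import Data.Nat.Divisibility using (_∣_; _∣?_; ∣-refl)
  open import Data.Nat.Primality using (Prime; prime⇒irreducible; ¬prime[0]; ¬prime[1])
  open import Data.Nat.Coprimality using (Coprime)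
  open import Data.Integer as ℤ using (+_)
  open import Data.Product using (∃; _×_; _,_; proj₁; proj₂)
  open import Data.Sum using (inj₁; inj₂)
  open import Data.Empty using (⊥-elim)
  open import Function using (_∘_; _⇔_; Equivalence)
  open import Relation.Binary.PropositionalEquality
  open import Relation.Nullary using (¬_; Dec; yes; no)

  prime∣⇒¬coprime : ∀ {p n} → Prime p → p ∣ n → ¬ Coprime p n
  prime∣⇒¬coprime p-prime p∣n p⊥n = ¬prime[1] (subst Prime (p⊥n (∣-refl , p∣n)) p-prime)

  ∣odd⇒≢2 : ∀ {p n} → p ∣ n → ¬ 2 ∣ n → p ≢ 2
  ∣odd⇒≢2 p∣n 2∤n refl = 2∤n p∣n

  prime≢2⇒odd : ∀ {p} → Prime p → p ≢ 2 → ¬ 2 ∣ p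
  prime≢2⇒odd p-prime p≢2 2∣p with prime⇒irreducible p-prime 2∣p
  ... | inj₁ ()
  ... | inj₂ 2≡p = p≢2 (sym 2≡p)

  oddPrime-shape : ∀ {p} → Prime p → p ≢ 2 → ∃ λ k → p ≡ suc (suc (suc k))
  oddPrime-shape {zero}              p-prime _   = ⊥-elim (¬prime[0] p-prime)
  oddPrime-shape {suc zero}          p-prime _   = ⊥-elim (¬prime[1] p-prime)
  oddPrime-shape {suc (suc zero)}    _       p≢2 = ⊥-elim (p≢2 refl)
  oddPrime-shape {suc (suc (suc k))} _       _   = k , refl

  θ-oddPrimePower-∤ : ∀ {p} r P → Prime p → p ≢ 2 → ¬ p ∣ P → ¬ p ∣ r → ∀ α → 1 ≤ α →
    (¬ 2 ∣ α → θ r P (p ^ α) ≡ ℤ.- (+ (p ^ (α ∸ 1)))) × (2 ∣ α → θ r P (p ^ α) ≡ + (p ^ (α ∸ 1) * (p ∸ 2)))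
  θ-oddPrimePower-∤ r P p-prime p≢2 p∤P p∤r α 1≤α with oddPrime-shape p-prime p≢2
  ... | _ , refl = θ-p^odd-∤ p∤r α , θ-p^even-∤ p∤r α 1≤α
    where open ThetaOddPrimePower p-prime r P p∤P

  θ-oddPrimePower-∣ : ∀ {p} r P → Prime p → p ≢ 2 → ¬ p ∣ P → p ∣ r → ∀ α → 1 ≤ α →
    (¬ 2 ∣ α → θ r P (p ^ α) ≡ + 0) × (2 ∣ α → θ r P (p ^ α) ≡ + (p ^ (α ∸ 1) * (p ∸ 1)))
  θ-oddPrimePower-∣ r P p-prime p≢2 p∤P p∣r α 1≤α with oddPrime-shape p-prime p≢2
  ... | _ , refl = θ-p^odd-∣ p∣r α , θ-p^even-∣ p∣r α 1≤α
    where open ThetaOddPrimePower p-prime r P p∤P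

  θ-oddPrimePower-cong : ∀ {p} r r′ P → Prime p → p ≢ 2 → ¬ p ∣ P → p ∣ r ⇔ p ∣ r′ →
    ∀ α → θ r P (p ^ α) ≡ θ r′ P (p ^ α)
  θ-oddPrimePower-cong         r r′ P p-prime p≢2 p∤P p∣r⇔p∣r′ zero = refl
  θ-oddPrimePower-cong {p} r r′ P p-prime p≢2 p∤P p∣r⇔p∣r′ α@(suc _) = by-cases (p ∣? r) (2 ∣? α)
    where
    open Equivalence p∣r⇔p∣r′
    ∣-values : ∀ s → p ∣ s →
      (¬ 2 ∣ α → θ s P (p ^ α) ≡ + 0) × (2 ∣ α → θ s P (p ^ α) ≡ + (p ^ (α ∸ 1) * (p ∸ 1)))
    ∣-values s p∣s = θ-oddPrimePower-∣ s P p-prime p≢2 p∤P p∣s α (s≤s z≤n)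
    ∤-values : ∀ s → ¬ p ∣ s →
      (¬ 2 ∣ α → θ s P (p ^ α) ≡ ℤ.- (+ (p ^ (α ∸ 1)))) × (2 ∣ α → θ s P (p ^ α) ≡ + (p ^ (α ∸ 1) * (p ∸ 2)))
    ∤-values s p∤s = θ-oddPrimePower-∤ s P p-prime p≢2 p∤P p∤s α (s≤s z≤n)
    by-cases : Dec (p ∣ r) → Dec (2 ∣ α) → θ r P (p ^ α) ≡ θ r′ P (p ^ α)
    by-cases (yes p∣r) (no  2∤α) = trans (proj₁ (∣-values r p∣r) 2∤α) (sym (proj₁ (∣-values r′ (to p∣r)) 2∤α))
    by-cases (yes p∣r) (yes 2∣α) = trans (proj₂ (∣-values r p∣r) 2∣α) (sym (proj₂ (∣-values r′ (to p∣r)) 2∣α))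
    by-cases (no  p∤r) (no  2∤α) = trans (proj₁ (∤-values r p∤r) 2∤α) (sym (proj₁ (∤-values r′ (p∤r ∘ from)) 2∤α))
    by-cases (no  p∤r) (yes 2∣α) = trans (proj₂ (∤-values r p∤r) 2∣α) (sym (proj₂ (∤-values r′ (p∤r ∘ from)) 2∣α))

open import Data.Nat using (ℕ; _*_; _^_; _∸_; _≤_; _<_)
open import Data.Nat.Divisibility using (_∣_)
open import Data.Nat.Primality using (Prime)
open import Data.Nat.Coprimality using (Coprime)
open import Data.Integer as ℤ using (ℤ; +_)
open import Data.Product using (_×_)
open import Relation.Nullary using (¬_)
open import Relation.Binary.PropositionalEquality using (_≡_; _≢_)

open import Data.Nat using (z≤n; s≤s)
import Data.Nat.Properties as ℕP
open import Data.Nat.Divisibility using (∣-refl; ∣m⇒∣m*n; ∣n⇒∣m*n)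
open import Data.Product using (_,_)
open import Relation.Binary.PropositionalEquality using (refl)
open TwoAdic using (υ₂≢1,2⇒2∣⇒8∣; oddPrime∣⇔∣oddPart)
open ThetaMultiplicative using (θ-*)
open ThetaPowerOfTwo using (θ-2^-odd; θ-2^-even)
open OddPrime

lemma3p8 : (P r : ℕ) → Prime P → P ≢ 2 → 0 < r →
  -- multiplicativity on {m > 0 : υ₂(m) ∉ {1,2}, (m,P) = 1}
  ((m n : ℕ) → 0 < m → υ₂ m ≢ 1 → υ₂ m ≢ 2 → Coprime m P →
    0 < n → υ₂ n ≢ 1 → υ₂ n ≢ 2 → Coprime n P → Coprime m n →
    θ r P (m * n) ≡ θ r P m ℤ.* θ r P n)
  ×
  -- r odd
  (¬ (2 ∣ r) →
    ((p α : ℕ) → Prime p → Coprime p (2 * r) → Coprime p P → 1 ≤ α →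
      (¬ (2 ∣ α) → θ r P (p ^ α) ≡ ℤ.- (+ (p ^ (α ∸ 1))))
      × (2 ∣ α → θ r P (p ^ α) ≡ + (p ^ (α ∸ 1) * (p ∸ 2))))
    × ((p α : ℕ) → Prime p → p ∣ r → Coprime p P → 1 ≤ α →
      (¬ (2 ∣ α) → θ r P (p ^ α) ≡ + 0)
      × (2 ∣ α → θ r P (p ^ α) ≡ + (p ^ (α ∸ 1) * (p ∸ 1))))
    × ((α : ℕ) → 3 ≤ α →
      θ r P (2 ^ α) ≡ (ℤ.- (+ 1)) ℤ.^ α ℤ.* + (2 ^ (α ∸ 1))))
  ×
  -- r even
  (2 ∣ r →
    ((α : ℕ) → 3 ≤ α → θ r P (2 ^ α) ≡ + 0)
    × ((p α : ℕ) → Prime p → p ≢ 2 → Coprime p P →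
      θ r P (p ^ α) ≡ θ (oddPart r) P (p ^ α)))
-- multiplicativity does not need (m, P) = (n, P) = 1
lemma3p8 P r P-prime P≢2 _ =
    (λ m n 0<m υ₂m≢1 υ₂m≢2 _ 0<n υ₂n≢1 υ₂n≢2 _ m⊥n →
      θ-* r P (0<m , υ₂≢1,2⇒2∣⇒8∣ υ₂m≢1 υ₂m≢2) (0<n , υ₂≢1,2⇒2∣⇒8∣ υ₂n≢1 υ₂n≢2) m⊥n)
  , (λ 2∤r →
        (λ p α p-prime p⊥2r p⊥P → θ-oddPrimePower-∤ r P p-prime
           (λ { refl → prime∣⇒¬coprime p-prime (∣m⇒∣m*n r ∣-refl) p⊥2r })
           (λ p∣P → prime∣⇒¬coprime p-prime p∣P p⊥P) (λ p∣r → prime∣⇒¬coprime p-prime (∣n⇒∣m*n 2 p∣r) p⊥2r) α)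
      , (λ p α p-prime p∣r p⊥P → θ-oddPrimePower-∣ r P p-prime (∣odd⇒≢2 p∣r 2∤r)
           (λ p∣P → prime∣⇒¬coprime p-prime p∣P p⊥P) p∣r α)
      , (λ α → θ-2^-odd α 2∤r (prime≢2⇒odd P-prime P≢2)))
  , (λ 2∣r →
        (λ α 3≤α → θ-2^-even r P α 2∣r (ℕP.≤-trans (s≤s z≤n) 3≤α))
      , (λ p α p-prime p≢2 p⊥P → θ-oddPrimePower-cong r (oddPart r) P p-prime p≢2
           (λ p∣P → prime∣⇒¬coprime p-prime p∣P p⊥P) (oddPrime∣⇔∣oddPart p-prime p≢2 r) α))
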